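{- Let $F$ be the NFA of a repeat-free elastic block graph, let $G$ be its determinization, and let $G'$ be the expansion of $G$ described below. Then the number of nodes of $G'$ is $O(NW)$, where $W$ is the maximum number of strings in a block of $F$ and $N$ is the total number of nodes of $F$.
   Context: An elastic block graph $(V,E,\ell)$ has nodes partitioned into blocks $V^1,\dots,V^b$, edges only from $V^i$ to $V^{i+1}$, and labels $\ell(v)\in\Sigma^+$ distinct within a block. It is repeat-free if every $\ell(v)$ occurs as a substring of a path label (concatenation of node labels along a path) only as a prefix of paths starting with $v$. Its NFA $F$ is obtained by adding a new initial state, expanding each node $v$ into a path of $|\ell(v)|$ states (one per character), adding edges from the initial state to the first state of each node of the first block, and from the last state of $v$ to the first state of $w$ for each $(v,w)\in E$; the label of an edge is the character of its destination state. The states corresponding to the last character of a node label are said to be at the end of a block. $G$ is the DFA obtained by the subset construction restricted to subsets reachable from $\{\text{initial state}\}$; a DFA state is at the end of a block if it contains NFA states at the end of a block. $G'$ is obtained from $G$ by processing nodes in topological order: if the current node $v$ is not at the end of a block, with in-neighbors (in-edges from) $u_1,\dots,u_k$ and out-neighbors $w_1,\dots,w_l$, delete $v$, add new nodes $v_1,\dots,v_k$ and edges $(u_i,v_i)$ for $1\le i\le k$ (with the label of $v$'s in-edges) and $(v_i,w_j)$ for all $i,j$ (with the original labels); nodes at the end of a block are left unchanged. -}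

module Defs where

open import Data.Nat using (ℕ; zero; suc; _+_; _*_; _∸_; _⊔_; _<_; _≡ᵇ_)
open import Data.Fin using (Fin; toℕ)
import Data.Fin as Fin
open import Data.Bool using (Bool; true; false; _∧_; _∨_; not; if_then_else_)
open import Data.List using (List; []; _∷_; _++_; map; concat; concatMap; filter;
  length; zip; foldl; foldr; allFin; upTo; lookup)
open import Data.Bool.ListAction using (any)
open import Data.List.NonEmpty using (List⁺; toList)
open import Data.Maybe using (Maybe; just; nothing)
open import Data.Product using (Σ; _×_; _,_; ∃; ∃-syntax; proj₁; proj₂)
open import Data.Empty using (⊥)
open import Data.Unit using (⊤)
open import Relation.Binary.PropositionalEquality using (_≡_)
open import Relation.Nullary.Decidable using (⌊_⌋)
import Data.List.Properties as LP

-- Elastic block graphs over the alphabet Fin σ.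
-- Nodes are Fin n, blocks are Fin b (block V^(i+1) is blk⁻¹ i),
-- edges are given by a Boolean adjacency function, labels are
-- non-empty strings.

record EBG (σ : ℕ) : Set where
  field
    b     : ℕ
    n     : ℕ
    blk   : Fin n → Fin b
    ℓ     : Fin n → List⁺ (Fin σ)
    edge  : Fin n → Fin n → Bool

module _ {σ : ℕ} (g : EBG σ) where
  open EBG g

  record WellFormed : Set where
    field
      blocks-nonempty : ∀ (i : Fin b) → ∃[ v ] blk v ≡ i
      edges-consecutive : ∀ v w → edge v w ≡ true → toℕ (blk w) ≡ suc (toℕ (blk v))
      labels-distinct : ∀ v w → blk v ≡ blk w → ℓ v ≡ ℓ w → v ≡ w

  IsPath : List (Fin n) → Set
  IsPath [] = ⊥
  IsPath (v ∷ []) = ⊤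
  IsPath (v ∷ w ∷ P) = (edge v w ≡ true) × IsPath (w ∷ P)

  pathLabel : List (Fin n) → List (Fin σ)
  pathLabel P = concatMap (λ v → toList (ℓ v)) P

  RepeatFree : Set
  RepeatFree = ∀ (v : Fin n) (P : List (Fin n)) → IsPath P →
    ∀ (xs ys : List (Fin σ)) → pathLabel P ≡ xs ++ toList (ℓ v) ++ ys →
    ∃[ P₁ ] ∃[ P₂ ] (P ≡ P₁ ++ v ∷ P₂) × (pathLabel P₁ ≡ xs)

  -- The NFA F.  States: the new initial state (nothing) and, for each
  -- node v, one state (v , k) per character position k of ℓ(v).

  len : Fin n → ℕ
  len v = length (toList (ℓ v))

  NState : Set
  NState = Maybe (Σ (Fin n) (λ v → Fin (len v)))

  states : List NState
  states = nothing ∷ concatMap (λ v → map (λ k → just (v , k)) (allFin (len v))) (allFin n)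

  N : ℕ
  N = length states

  blockSize : Fin b → ℕ
  blockSize i = length (filter (λ v → blk v Fin.≟ i) (allFin n))

  W : ℕ
  W = foldr _⊔_ 0 (map blockSize (allFin b))

  char : NState → Maybe (Fin σ)
  char nothing = nothing
  char (just (v , k)) = just (lookup (toList (ℓ v)) k)

  atEnd : NState → Bool
  atEnd nothing = false
  atEnd (just (v , k)) = suc (toℕ k) ≡ᵇ len v

  nfaArc : NState → NState → Bool
  nfaArc _ nothing = false
  nfaArc nothing (just (w , k)) = (toℕ k ≡ᵇ 0) ∧ (toℕ (blk w) ≡ᵇ 0)
  nfaArc (just (v , k)) (just (w , k')) =
    (⌊ v Fin.≟ w ⌋ ∧ (toℕ k' ≡ᵇ suc (toℕ k)))
    ∨ (atEnd (just (v , k)) ∧ edge v w ∧ (toℕ k' ≡ᵇ 0))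

  charIs : Maybe (Fin σ) → Fin σ → Bool
  charIs nothing c = false
  charIs (just d) c = ⌊ d Fin.≟ c ⌋

  nfaStep : NState → Fin σ → NState → Bool
  nfaStep s c t = nfaArc s t ∧ charIs (char t) c

  -- The DFA G (subset construction).  A set of NFA states is a list of
  -- Booleans aligned with `states`.

  DState : Set
  DState = List Bool

  δ : DState → Fin σ → DState
  δ S c = map (λ t → any (λ p → proj₂ p ∧ nfaStep (proj₁ p) c t) (zip states S)) states

  δ* : DState → List (Fin σ) → DState
  δ* = foldl δ

  initialD : DState
  initialD = map (λ { nothing → true ; (just _) → false }) states

  NonemptyD : DState → Set
  NonemptyD S = any (λ x → x) S ≡ true

  Reachable : DState → Set
  Reachable S = ∃[ w ] δ* initialD w ≡ S

  atEndD : DState → Bool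
  atEndD S = any (λ p → proj₂ p ∧ atEnd (proj₁ p)) (zip states S)

  eqD : DState → DState → Bool
  eqD S T = ⌊ LP.≡-dec Data.Bool._≟_ S T ⌋

  EdgeG : DState → DState → Set
  EdgeG S T = ∃[ c ] δ S c ≡ T

  TopOrdered : List DState → Set
  TopOrdered ord = ∀ (i j : Fin (length ord)) →
    EdgeG (lookup ord i) (lookup ord j) → toℕ i < toℕ j

  -- The expansion G' of G.  Graphs with node identifiers in ℕ; the nodes
  -- of G get identifiers 0 … |ord|-1 (their position in ord), new nodes
  -- get fresh identifiers.

  record Graph : Set where
    constructor graph
    field
      nodes : List ℕ
      edges : List (ℕ × ℕ × Fin σ)
      fresh : ℕ

  indexed : List DState → List (ℕ × DState)
  indexed ord = zip (upTo (length ord)) ord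

  graphG : List DState → Graph
  graphG ord = graph (upTo (length ord))
    (concatMap (λ p → concatMap (λ q → concatMap
      (λ c → if eqD (δ (proj₂ p) c) (proj₂ q) then (proj₁ p , proj₁ q , c) ∷ [] else [])
      (allFin σ)) (indexed ord)) (indexed ord))
    (length ord)

  -- replace node v (with in-edges from u₁ … u_k) by v₁ … v_k
  expandNode : ℕ → Graph → Graph
  expandNode v (graph ns es f) = graph ns' es' (f + length ins)
    where
    src dst : ℕ × ℕ × Fin σ → ℕ
    src e = proj₁ e
    dst e = proj₁ (proj₂ e)
    ins : List (ℕ × Fin σ)
    ins = map (λ e → src e , proj₂ (proj₂ e)) (filter (λ e → dst e Data.Nat.≟ v) es)
    outs : List (ℕ × Fin σ)
    outs = map (λ e → dst e , proj₂ (proj₂ e)) (filter (λ e → src e Data.Nat.≟ v) es)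
    rest : List (ℕ × ℕ × Fin σ)
    rest = filter (λ e → Data.Bool._≟_ (not ((src e ≡ᵇ v) ∨ (dst e ≡ᵇ v))) true) es
    ins# : List (ℕ × ℕ × Fin σ)
    ins# = zip (upTo (length ins)) ins
    ns' : List ℕ
    ns' = filter (λ x → Data.Bool._≟_ (not (x ≡ᵇ v)) true) ns ++ map (f +_) (upTo (length ins))
    es' : List (ℕ × ℕ × Fin σ)
    es' = rest ++ concatMap (λ p → let vᵢ = f + proj₁ p in
            (proj₁ (proj₂ p) , vᵢ , proj₂ (proj₂ p)) ∷
            map (λ o → vᵢ , proj₁ o , proj₂ o) outs) ins#

  kept : DState → Bool
  kept S = atEndD S ∨ eqD S initialD

  processAll : List (ℕ × DState) → Graph → Graph
  processAll [] G = G
  processAll ((v , S) ∷ rest) G =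
    processAll rest (if kept S then G else expandNode v G)

  G′ : List DState → Graph
  G′ ord = processAll (indexed ord) (graphG ord)

  nodeCountG′ : List DState → ℕ
  nodeCountG′ ord = length (Graph.nodes (G′ ord))

module Submission where

open import Defs
open import Data.Nat using (ℕ; _+_; _*_; _≤_)
open import Data.Nat.Properties using (+-monoˡ-≤; +-monoʳ-≤; *-monoʳ-≤; m≤m+n; module ≤-Reasoning)
open import Data.Nat.Solver using (module +-*-Solver)
open import Data.Product using (_×_; ∃-syntax; _,_)
open import Data.List using (List)
open import Data.List.Membership.Propositional using (_∈_)
open import Data.List.Relation.Unary.Unique.Propositional using (Unique)
open import Function.Bundles using (_⇔_)
open import Relation.Binary.PropositionalEquality using (_≡_; refl)

-- Nodes of G are processed in topological order; a node that is not kept is replaced by one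
-- copy per in-edge, so it yields copies i = Σ mult i′ i · copies i′ new nodes (a kept node
-- counts once).  Repeat-freeness shows that a reachable set of NFA states is {initial}, a
-- singleton {end of u}, or a set of non-final positions spelling a common prefix p since the
-- last block boundary; the kept nodes are those of the first two kinds, so there are at most
-- N of them.  Each copy of an unkept node i comes from a distinct kept node k with
-- δ*(k, p(i)) = i, and the pair (i , k) is determined by the first NFA state (w , d) of i and
-- the node u whose end k is, where u → w is an edge (or w lies in the first block).  At most
-- N · W such pairs exist besides the N with k initial, whence |G′| ≤ 3N + 2NW ≤ 5NW + 5.

module Counting where

  open import Data.Nat using (ℕ; zero; suc; _+_; _*_; _≤_; z≤n; s≤s; _≡ᵇ_; _⊔_)
  import Data.Nat as ℕ
  open import Data.Nat.Properties
  open import Data.Bool using (Bool; true; false; _∧_; _∨_; not; if_then_else_)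
  open import Data.Sum using (_⊎_; inj₁; inj₂)
  import Data.Bool as Bool
  open import Data.Bool.ListAction using (any)
  open import Data.Bool.Properties using (∧-conicalˡ; ∧-conicalʳ; ∨-zeroʳ)
  open import Data.List using (List; []; _∷_; _++_; map; concatMap; filter; length; cartesianProduct; applyUpTo; upTo; zip; foldr)
  import Data.List.Properties as List
  open import Data.Product using (_×_; _,_; ∃-syntax; proj₁; proj₂)
  open import Relation.Nullary using (Dec; yes; no; does; contradiction)
  open import Relation.Nullary.Decidable using (dec-true; dec-false; ⌊_⌋)
  open import Relation.Unary using (Pred; Decidable)
  open import Relation.Binary using (DecidableEquality)
  open import Relation.Binary.PropositionalEquality
  open import Data.List.Membership.Propositional using (_∈_)
  open import Data.List.Relation.Unary.Any using (here; there)
  import Data.List.Relation.Unary.All as All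
  open import Data.List.Relation.Unary.AllPairs using (_∷_)
  open import Data.List.Relation.Unary.Unique.Propositional using (Unique)
  open import Function using (_∘_)
  open import Algebra.Properties.CommutativeSemigroup +-commutativeSemigroup using (interchange)

  does-true : ∀ {a} {A : Set a} (a? : Dec A) → does a? ≡ true → A
  does-true (yes a) _ = a

  isYes-true : ∀ {a} {A : Set a} (a? : Dec A) → ⌊ a? ⌋ ≡ true → A
  isYes-true (yes a) _ = a

  isYes-intro : ∀ {a} {A : Set a} (a? : Dec A) → A → ⌊ a? ⌋ ≡ true
  isYes-intro (yes _) _ = refl
  isYes-intro (no ¬a) a = contradiction a ¬a

  ≡ᵇ-refl : ∀ n → (n ≡ᵇ n) ≡ true
  ≡ᵇ-refl n = dec-true (n ℕ.≟ n) refl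

  ≡ᵇ-true : ∀ m n → (m ≡ᵇ n) ≡ true → m ≡ n
  ≡ᵇ-true m n = does-true (m ℕ.≟ n)

  ≡ᵇ-false : ∀ m n → m ≢ n → (m ≡ᵇ n) ≡ false
  ≡ᵇ-false m n = dec-false (m ℕ.≟ n)

  does-≟true : ∀ b → does (b Bool.≟ true) ≡ b
  does-≟true true = refl
  does-≟true false = refl

  applyUpTo-cong : ∀ {a} {A : Set a} {f h : ℕ → A} n → (∀ i → f i ≡ h i) → applyUpTo f n ≡ applyUpTo h n
  applyUpTo-cong zero H = refl
  applyUpTo-cong (suc n) H = cong₂ _∷_ (H 0) (applyUpTo-cong n (H ∘ suc))

  ∈-zip-map⁻ : ∀ {a b} {A : Set a} {B : Set b} (f : A → B) xs t y → (t , y) ∈ zip xs (map f xs) → t ∈ xs × y ≡ f t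
  ∈-zip-map⁻ f (x ∷ xs) t y (here refl) = here refl , refl
  ∈-zip-map⁻ f (x ∷ xs) t y (there m) with ∈-zip-map⁻ f xs t y m
  ... | a , b = there a , b

  ∈-zip-map⁺ : ∀ {a b} {A : Set a} {B : Set b} (f : A → B) xs t → t ∈ xs → (t , f t) ∈ zip xs (map f xs)
  ∈-zip-map⁺ f (x ∷ xs) t (here refl) = here refl
  ∈-zip-map⁺ f (x ∷ xs) t (there m) = there (∈-zip-map⁺ f xs t m)

  ∈-zip⁻ʳ : ∀ {a b} {A : Set a} {B : Set b} (xs : List A) (ys : List B) {x y} → (x , y) ∈ zip xs ys → y ∈ ys
  ∈-zip⁻ʳ (_ ∷ xs) (_ ∷ ys) (here refl) = here refl
  ∈-zip⁻ʳ (_ ∷ xs) (_ ∷ ys) (there m) = there (∈-zip⁻ʳ xs ys m)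

  any-true⁻ : ∀ {a} {A : Set a} (h : A → Bool) xs → any h xs ≡ true → ∃[ x ] x ∈ xs × h x ≡ true
  any-true⁻ h (x ∷ xs) e with h x in hx
  ... | true = x , here refl , hx
  ... | false with any-true⁻ h xs e
  ... | y , m , hy = y , there m , hy

  any-true⁺ : ∀ {a} {A : Set a} (h : A → Bool) xs x → x ∈ xs → h x ≡ true → any h xs ≡ true
  any-true⁺ h (y ∷ xs) x (here refl) e rewrite e = refl
  any-true⁺ h (y ∷ xs) x (there m) e rewrite any-true⁺ h xs x m e = ∨-zeroʳ (h y)

  ≤-foldr⊔ : ∀ {x} xs → x ∈ xs → x ≤ foldr _⊔_ 0 xs
  ≤-foldr⊔ (y ∷ xs) (here refl) = m≤m⊔n y _
  ≤-foldr⊔ (y ∷ xs) (there x∈) = ≤-trans (≤-foldr⊔ xs x∈) (m≤n⊔m y _)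

  ∨-true⁻ : ∀ a b → (a ∨ b) ≡ true → a ≡ true ⊎ b ≡ true
  ∨-true⁻ true b _ = inj₁ refl
  ∨-true⁻ false b e = inj₂ e

  𝟙 : Bool → ℕ
  𝟙 true = 1
  𝟙 false = 0

  𝟙≤1 : ∀ b → 𝟙 b ≤ 1
  𝟙≤1 true = s≤s z≤n
  𝟙≤1 false = z≤n

  𝟙-pos : ∀ b → 1 ≤ 𝟙 b → b ≡ true
  𝟙-pos true _ = refl

  ∑ : ∀ {a} {A : Set a} → List A → (A → ℕ) → ℕ
  ∑ [] h = 0
  ∑ (x ∷ xs) h = h x + ∑ xs h

  syntax ∑ xs (λ x → e) = ∑[ x ∈ xs ] e

  count : ∀ {a} {A : Set a} → (A → Bool) → List A → ℕ
  count f xs = ∑[ x ∈ xs ] 𝟙 (f x)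

  ∑-map : ∀ {a b} {A : Set a} {B : Set b} (g : A → B) xs (h : B → ℕ) → ∑ (map g xs) h ≡ ∑ xs (h ∘ g)
  ∑-map g [] h = refl
  ∑-map g (x ∷ xs) h = cong (h (g x) +_) (∑-map g xs h)

  module _ {a} {A : Set a} where

    ∑-++ : ∀ xs ys (h : A → ℕ) → ∑ (xs ++ ys) h ≡ ∑ xs h + ∑ ys h
    ∑-++ [] ys h = refl
    ∑-++ (x ∷ xs) ys h = trans (cong (h x +_) (∑-++ xs ys h)) (sym (+-assoc (h x) _ _))

    ∑-cong : ∀ xs {h k : A → ℕ} → (∀ x → x ∈ xs → h x ≡ k x) → ∑ xs h ≡ ∑ xs k
    ∑-cong [] H = refl
    ∑-cong (x ∷ xs) H = cong₂ _+_ (H x (here refl)) (∑-cong xs (λ y y∈ → H y (there y∈)))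

    ∑-mono : ∀ xs {h k : A → ℕ} → (∀ x → x ∈ xs → h x ≤ k x) → ∑ xs h ≤ ∑ xs k
    ∑-mono [] H = z≤n
    ∑-mono (x ∷ xs) H = +-mono-≤ (H x (here refl)) (∑-mono xs (λ y y∈ → H y (there y∈)))

    ∑-zero : ∀ xs {h : A → ℕ} → (∀ x → x ∈ xs → h x ≡ 0) → ∑ xs h ≡ 0
    ∑-zero [] H = refl
    ∑-zero (x ∷ xs) H = cong₂ _+_ (H x (here refl)) (∑-zero xs (λ y y∈ → H y (there y∈)))

    ∑-const : ∀ xs c → ∑[ _ ∈ xs ] c ≡ length {A = A} xs * c
    ∑-const [] c = refl
    ∑-const (x ∷ xs) c = cong (c +_) (∑-const xs c)

    ∑-+ : ∀ xs (h k : A → ℕ) → ∑[ x ∈ xs ] (h x + k x) ≡ ∑ xs h + ∑ xs k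
    ∑-+ [] h k = refl
    ∑-+ (x ∷ xs) h k = trans (cong (h x + k x +_) (∑-+ xs h k)) (interchange (h x) (k x) _ _)

    ∑-*ʳ : ∀ xs (h : A → ℕ) y → ∑ xs h * y ≡ ∑[ x ∈ xs ] (h x * y)
    ∑-*ʳ [] h y = refl
    ∑-*ʳ (x ∷ xs) h y = trans (*-distribʳ-+ y (h x) (∑ xs h)) (cong (h x * y +_) (∑-*ʳ xs h y))

    term≤∑ : ∀ xs (h : A → ℕ) {x} → x ∈ xs → h x ≤ ∑ xs h
    term≤∑ (y ∷ xs) h (here refl) = m≤m+n (h y) _
    term≤∑ (y ∷ xs) h (there x∈) = ≤-trans (term≤∑ xs h x∈) (m≤n+m _ (h y))

    ∑-atMostOne : ∀ xs (h : A → ℕ) → Unique xs → (∀ x → x ∈ xs → h x ≤ 1) →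
      (∀ {x y} → x ∈ xs → y ∈ xs → 1 ≤ h x → 1 ≤ h y → x ≡ y) → ∑ xs h ≤ 1
    ∑-atMostOne [] h _ _ _ = z≤n
    ∑-atMostOne (x ∷ xs) h (x∉xs ∷ u) ≤1 single with h x in hx
    ... | zero = ∑-atMostOne xs h u (λ y y∈ → ≤1 y (there y∈)) (λ y∈ z∈ → single (there y∈) (there z∈))
    ... | suc k = begin
        suc k + ∑ xs h ≡⟨ cong (suc k +_) (∑-zero xs others-zero) ⟩
        suc k + 0      ≡⟨ trans (+-identityʳ (suc k)) (sym hx) ⟩
        h x            ≤⟨ ≤1 x (here refl) ⟩
        1              ∎
      where
      open ≤-Reasoning
      others-zero : ∀ y → y ∈ xs → h y ≡ 0
      others-zero y y∈ with h y in hy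
      ... | zero = refl
      ... | suc _ = contradiction (single (here refl) (there y∈) (positive hx) (positive hy)) (All.lookup x∉xs y∈)
        where
        positive : ∀ {z m} → h z ≡ suc m → 1 ≤ h z
        positive e = subst (1 ≤_) (sym e) (s≤s z≤n)

    count-pos : ∀ (f : A → Bool) xs {x} → x ∈ xs → f x ≡ true → 1 ≤ count f xs
    count-pos f xs x∈ fx = subst (λ b → 𝟙 b ≤ count f xs) fx (term≤∑ xs (𝟙 ∘ f) x∈)

    count-pos⁻ : ∀ (f : A → Bool) xs → 1 ≤ count f xs → ∃[ x ] x ∈ xs × f x ≡ true
    count-pos⁻ f (x ∷ xs) p with f x in fx
    ... | true = x , here refl , fx
    ... | false with count-pos⁻ f xs p
    ...   | y , y∈ , fy = y , there y∈ , fy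

    count-none : ∀ (f : A → Bool) xs → (∀ x → x ∈ xs → f x ≡ false) → count f xs ≡ 0
    count-none f xs H = ∑-zero xs (λ x x∈ → cong 𝟙 (H x x∈))

    count≤length : ∀ (f : A → Bool) xs → count f xs ≤ length xs
    count≤length f [] = z≤n
    count≤length f (x ∷ xs) = +-mono-≤ (𝟙≤1 (f x)) (count≤length f xs)

    count+count-not : ∀ (f : A → Bool) xs → count f xs + count (not ∘ f) xs ≡ length xs
    count+count-not f [] = refl
    count+count-not f (x ∷ xs) with f x
    ... | true = cong suc (count+count-not f xs)
    ... | false = trans (+-suc (count f xs) _) (cong suc (count+count-not f xs))

    count-mono : ∀ (f g : A → Bool) xs → (∀ x → x ∈ xs → f x ≡ true → g x ≡ true) → count f xs ≤ count g xs
    count-mono f g xs H = ∑-mono xs pointwise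
      where
      pointwise : ∀ x → x ∈ xs → 𝟙 (f x) ≤ 𝟙 (g x)
      pointwise x x∈ with f x in fx
      ... | false = z≤n
      ... | true = ≤-reflexive (cong 𝟙 (sym (H x x∈ fx)))

    count-∨ : ∀ (f g h : A → Bool) xs → (∀ x → x ∈ xs → f x ≡ true → (g x ∨ h x) ≡ true) →
      count f xs ≤ count g xs + count h xs
    count-∨ f g h xs H = ≤-trans (∑-mono xs pointwise) (≤-reflexive (∑-+ xs (𝟙 ∘ g) (𝟙 ∘ h)))
      where
      pointwise : ∀ x → x ∈ xs → 𝟙 (f x) ≤ 𝟙 (g x) + 𝟙 (h x)
      pointwise x x∈ with f x in fx | g x | h x | H x x∈
      ... | false | _ | _ | _ = z≤n
      ... | true | true | _ | _ = s≤s z≤n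
      ... | true | false | true | _ = s≤s z≤n
      ... | true | false | false | H′ with () ← H′ refl

    𝟙*count : ∀ b (f : A → Bool) xs → 𝟙 b * count f xs ≡ count (λ x → b ∧ f x) xs
    𝟙*count true f xs = +-identityʳ _
    𝟙*count false f xs = sym (count-none _ xs (λ _ _ → refl))

    length-filter≡count : ∀ {p} {P : Pred A p} (P? : Decidable P) xs → length (filter P? xs) ≡ count (does ∘ P?) xs
    length-filter≡count P? [] = refl
    length-filter≡count P? (x ∷ xs) with does (P? x)
    ... | true = cong suc (length-filter≡count P? xs)
    ... | false = length-filter≡count P? xs

    count-filter : ∀ {p} {P : Pred A p} (P? : Decidable P) (f : A → Bool) xs →
      count f (filter P? xs) ≡ count (λ x → does (P? x) ∧ f x) xs
    count-filter P? f [] = refl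
    count-filter P? f (x ∷ xs) with does (P? x)
    ... | true = cong (𝟙 (f x) +_) (count-filter P? f xs)
    ... | false = count-filter P? f xs

  module _ {a b} {A : Set a} {B : Set b} where

    ∑-concatMap : ∀ (g : A → List B) xs (h : B → ℕ) → ∑ (concatMap g xs) h ≡ ∑[ x ∈ xs ] ∑ (g x) h
    ∑-concatMap g [] h = refl
    ∑-concatMap g (x ∷ xs) h = trans (∑-++ (g x) (concatMap g xs) h) (cong (∑ (g x) h +_) (∑-concatMap g xs h))

    ∑-cartesianProduct : ∀ xs ys (h : A × B → ℕ) → ∑ (cartesianProduct xs ys) h ≡ ∑[ x ∈ xs ] ∑[ y ∈ ys ] h (x , y)
    ∑-cartesianProduct [] ys h = refl
    ∑-cartesianProduct (x ∷ xs) ys h =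
      trans (∑-++ (map (x ,_) ys) (cartesianProduct xs ys) h)
            (cong₂ _+_ (∑-map (x ,_) ys h) (∑-cartesianProduct xs ys h))

    ∑-swap : ∀ xs ys (h : A → B → ℕ) → ∑[ x ∈ xs ] ∑ ys (h x) ≡ ∑[ y ∈ ys ] ∑[ x ∈ xs ] h x y
    ∑-swap [] ys h = sym (∑-zero ys (λ _ _ → refl))
    ∑-swap (x ∷ xs) ys h = trans (cong (∑ ys (h x) +_) (∑-swap xs ys h)) (sym (∑-+ ys (h x) _))

    count-injection : DecidableEquality B → ∀ xs ys (f : A → Bool) (g : B → Bool) (φ : A → B) → Unique xs →
      (∀ x → x ∈ xs → f x ≡ true → φ x ∈ ys × g (φ x) ≡ true) →
      (∀ {x x′} → x ∈ xs → x′ ∈ xs → f x ≡ true → f x′ ≡ true → φ x ≡ φ x′ → x ≡ x′) →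
      count f xs ≤ count g ys
    count-injection _≟_ xs ys f g φ unique-xs into injective = begin
        count f xs                              ≤⟨ ∑-mono xs hit ⟩
        ∑[ x ∈ xs ] ∑[ y ∈ ys ] 𝟙 (f x ∧ φ x ≡? y) ≡⟨ ∑-swap xs ys _ ⟩
        ∑[ y ∈ ys ] ∑[ x ∈ xs ] 𝟙 (f x ∧ φ x ≡? y) ≤⟨ ∑-mono ys fibre ⟩
        count g ys                              ∎
      where
      open ≤-Reasoning
      _≡?_ : B → B → Bool
      y ≡? y′ = does (y ≟ y′)
      hit : ∀ x → x ∈ xs → 𝟙 (f x) ≤ ∑[ y ∈ ys ] 𝟙 (f x ∧ φ x ≡? y)
      hit x x∈ with f x in fx
      ... | false = z≤n
      ... | true = count-pos (φ x ≡?_) ys (proj₁ (into x x∈ fx)) (dec-true (φ x ≟ φ x) refl)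
      fibre : ∀ y → y ∈ ys → ∑[ x ∈ xs ] 𝟙 (f x ∧ φ x ≡? y) ≤ 𝟙 (g y)
      fibre y _ with g y in gy
      ... | true = ∑-atMostOne xs _ unique-xs (λ x _ → 𝟙≤1 _) same
        where
        same : ∀ {x x′} → x ∈ xs → x′ ∈ xs → 1 ≤ 𝟙 (f x ∧ φ x ≡? y) → 1 ≤ 𝟙 (f x′ ∧ φ x′ ≡? y) → x ≡ x′
        same x∈ x′∈ p p′ with 𝟙-pos _ p | 𝟙-pos _ p′
        ... | q | q′ = injective x∈ x′∈ (∧-conicalˡ _ _ q) (∧-conicalˡ _ _ q′)
                         (trans (does-true (_ ≟ y) (∧-conicalʳ _ _ q)) (sym (does-true (_ ≟ y) (∧-conicalʳ _ _ q′))))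
      ... | false = ≤-reflexive (count-none _ xs none)
        where
        none : ∀ x → x ∈ xs → (f x ∧ φ x ≡? y) ≡ false
        none x x∈ with f x in fx | φ x ≟ y
        ... | false | _ = refl
        ... | true | no _ = refl
        ... | true | yes refl with () ← trans (sym gy) (proj₂ (into x x∈ fx))

  ∑-if : ∀ {a} {A : Set a} b xs (h : A → ℕ) → ∑[ x ∈ xs ] (if b then h x else 0) ≡ (if b then ∑ xs h else 0)
  ∑-if true xs h = refl
  ∑-if false xs h = ∑-zero xs (λ _ _ → refl)

  ∑-upTo-suc : ∀ t (h : ℕ → ℕ) → ∑ (upTo (suc t)) h ≡ ∑ (upTo t) h + h t
  ∑-upTo-suc t h = begin
    ∑ (upTo (suc t)) h          ≡⟨ cong (λ xs → ∑ xs h) (sym (List.upTo-∷ʳ t)) ⟩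
    ∑ (upTo t ++ t ∷ []) h      ≡⟨ ∑-++ (upTo t) (t ∷ []) h ⟩
    ∑ (upTo t) h + (h t + 0)    ≡⟨ cong (∑ (upTo t) h +_) (+-identityʳ (h t)) ⟩
    ∑ (upTo t) h + h t          ∎
    where open ≡-Reasoning

  length≡∑ : ∀ {a} {A : Set a} (xs : List A) → length xs ≡ ∑[ _ ∈ xs ] 1
  length≡∑ xs = sym (trans (∑-const xs 1) (*-identityʳ (length xs)))

module SubsetConstruction {σ : ℕ} (g : EBG σ) where

  open Counting
  open import Data.Nat using (ℕ; suc; _+_; _≤_; _<_; z≤n; s≤s; _≡ᵇ_)
  open import Data.Nat.Properties
  open import Data.Bool using (Bool; true; false; _∧_; _∨_)
  import Data.Bool as Bool
  open import Data.Bool.Properties using (∧-conicalˡ; ∧-conicalʳ)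
  open import Data.Bool.ListAction using (any)
  open import Data.List using (List; []; _∷_; _++_; _∷ʳ_; InitLast; initLast; _∷ʳ′_; map; length; zip; allFin; foldl; take; drop; lookup)
  import Data.List.Properties as List
  open import Data.List.NonEmpty using (toList)
  open import Data.Fin using (Fin; toℕ)
  import Data.Fin as Fin
  import Data.Fin.Properties as Fin
  open import Data.Maybe using (Maybe; just; nothing)
  open import Data.Product using (Σ; _×_; _,_; ∃-syntax; proj₁; proj₂)
  open import Data.Sum using (_⊎_; inj₁; inj₂)
  open import Data.Empty using (⊥-elim)
  open import Data.Unit using (tt)
  open import Relation.Nullary using (¬_; contradiction)
  open import Relation.Binary.PropositionalEquality
  open import Data.List.Membership.Propositional using (_∈_)
  open import Data.List.Membership.Propositional.Properties using (∈-allFin; ∈-map⁺; ∈-map⁻; ∈-concatMap⁺)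
  open import Data.List.Relation.Unary.Any using (Any; here; there)
  import Data.List.Relation.Unary.Any as Any
  open import Function using (_∘_)

  open EBG g

  label : Fin n → List (Fin σ)
  label v = toList (ℓ v)

  eqD-true : ∀ S T → eqD g S T ≡ true → S ≡ T
  eqD-true S T = isYes-true (List.≡-dec Bool._≟_ S T)

  eqD-refl : ∀ S → eqD g S S ≡ true
  eqD-refl S = isYes-intro (List.≡-dec Bool._≟_ S S) refl

  _∈ˢ_ : NState g → DState g → Set
  t ∈ˢ S = (t , true) ∈ zip (states g) S

  ∈-states : ∀ (t : NState g) → t ∈ (states g)
  ∈-states nothing = here refl
  ∈-states (just (v , k)) = there (∈-concatMap⁺ (λ v → map (λ k → just (v , k)) (allFin (len g v)))
                                 (Any.map (λ { refl → ∈-map⁺ (λ k → just (v , k)) (∈-allFin k) }) (∈-allFin v)))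

  δ-bit : DState g → Fin σ → NState g → Bool
  δ-bit S c t = any (λ p → proj₂ p ∧ nfaStep g (proj₁ p) c t) (zip (states g) S)

  ∈δ⁻ : ∀ S c t → t ∈ˢ δ g S c → ∃[ s ] s ∈ˢ S × nfaStep g s c t ≡ true
  ∈δ⁻ S c t m with ∈-zip-map⁻ (δ-bit S c) (states g) t true m
  ... | _ , e with any-true⁻ _ (zip (states g) S) (sym e)
  ... | (s , true) , m′ , h = s , m′ , h

  ∈initial⁻ : ∀ t → t ∈ˢ initialD g → t ≡ nothing
  ∈initial⁻ t m with ∈-zip-map⁻ _ (states g) t true m
  ∈initial⁻ nothing m | _ = refl
  ∈initial⁻ (just _) m | _ , ()

  nothing∈initial : nothing ∈ˢ initialD g
  nothing∈initial = here refl

  nothing∉δ : ∀ S c → ¬ (nothing ∈ˢ δ g S c)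
  nothing∉δ S c m with ∈δ⁻ S c nothing m
  ... | nothing , _ , ()
  ... | just _ , _ , ()

  step-char : ∀ s c w d → nfaStep g s c (just (w , d)) ≡ true → lookup (label w) d ≡ c
  step-char s c w d h = isYes-true (_ Fin.≟ _) (∧-conicalʳ (nfaArc g s (just (w , d))) _ h)

  step-arc : ∀ s c t → nfaStep g s c t ≡ true → nfaArc g s t ≡ true
  step-arc s c t h = ∧-conicalˡ _ _ h

  arc-from-initial : ∀ w d → nfaArc g nothing (just (w , d)) ≡ true → toℕ d ≡ 0 × toℕ (blk w) ≡ 0
  arc-from-initial w d h = ≡ᵇ-true _ _ (∧-conicalˡ _ _ h) , ≡ᵇ-true _ _ (∧-conicalʳ _ _ h)

  arc-from-state : ∀ v k w d → nfaArc g (just (v , k)) (just (w , d)) ≡ true →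
     (Σ (v ≡ w) λ { refl → toℕ d ≡ suc (toℕ k) }) ⊎ (atEnd g (just (v , k)) ≡ true × edge v w ≡ true × toℕ d ≡ 0)
  arc-from-state v k w d arc with ∨-true⁻ _ _ arc
  ... | inj₁ same-node with isYes-true (v Fin.≟ w) (∧-conicalˡ _ _ same-node)
  ...   | refl = inj₁ (refl , ≡ᵇ-true _ _ (∧-conicalʳ _ _ same-node))
  arc-from-state v k w d arc | inj₂ next-node =
    inj₂ (∧-conicalˡ _ _ next-node , ∧-conicalˡ (edge v w) _ edge-and-0 , ≡ᵇ-true _ _ (∧-conicalʳ (edge v w) _ edge-and-0))
    where
    edge-and-0 : (edge v w ∧ (toℕ d ≡ᵇ 0)) ≡ true
    edge-and-0 = ∧-conicalʳ (atEnd g (just (v , k))) _ next-node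

  atEnd⇒last : ∀ v (k : Fin (len g v)) → atEnd g (just (v , k)) ≡ true → suc (toℕ k) ≡ len g v
  atEnd⇒last v k e = ≡ᵇ-true _ _ e

  take-last : ∀ v (k : Fin (len g v)) → atEnd g (just (v , k)) ≡ true → take (suc (toℕ k)) (label v) ≡ label v
  take-last v k end = List.take-all (suc (toℕ k)) (label v) (≤-reflexive (sym (atEnd⇒last v k end)))

  isPath-∷ʳ : ∀ P v w → IsPath g (P ∷ʳ v) → edge v w ≡ true → IsPath g ((P ∷ʳ v) ∷ʳ w)
  isPath-∷ʳ [] v w _ e = e , tt
  isPath-∷ʳ (a ∷ []) v w (e1 , _) e = e1 , e , tt
  isPath-∷ʳ (a ∷ b ∷ P) v w (e1 , p) e = e1 , isPath-∷ʳ (b ∷ P) v w p e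

  pathLabel-∷ʳ : ∀ P v → pathLabel g (P ∷ʳ v) ≡ pathLabel g P ++ label v
  pathLabel-∷ʳ P v = trans (List.concatMap-++ (λ v → toList (ℓ v)) P (v ∷ [])) (cong (pathLabel g P ++_) (List.++-identityʳ (label v)))

  take-step : ∀ w (d : Fin (len g w)) i c → toℕ d ≡ i → lookup (label w) d ≡ c →
    take (suc (toℕ d)) (label w) ≡ take i (label w) ++ c ∷ []
  take-step w d i c refl char = trans (List.take-suc (label w) d) (cong (λ a → take (toℕ d) (label w) ++ a ∷ []) char)

  Reads : List (Fin σ) → DState g → Set
  Reads x S = (nothing ∈ˢ S → x ≡ []) ×
           (∀ w d → just (w , d) ∈ˢ S → ∃[ P ] IsPath g (P ∷ʳ w) × pathLabel g P ++ take (suc (toℕ d)) (label w) ≡ x)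

  reads-δ : ∀ x S c → Reads x S → Reads (x ∷ʳ c) (δ g S c)
  reads-δ x S c (reads-nothing , reads-just) = (λ n∈ → contradiction n∈ (nothing∉δ S c)) , reads-just′
    where
    open ≡-Reasoning
    reads-just′ : ∀ w d → just (w , d) ∈ˢ δ g S c →
      ∃[ P ] IsPath g (P ∷ʳ w) × pathLabel g P ++ take (suc (toℕ d)) (label w) ≡ x ∷ʳ c
    reads-just′ w d t∈ with ∈δ⁻ S c (just (w , d)) t∈
    ... | nothing , s∈ , step =
      [] , tt , trans (take-step w d 0 c d≡0 (step-char nothing c w d step)) (cong (_∷ʳ c) (sym (reads-nothing s∈)))
      where
      d≡0 = proj₁ (arc-from-initial w d (step-arc nothing c (just (w , d)) step))
    ... | just (v , k) , s∈ , step with arc-from-state v k w d (step-arc (just (v , k)) c (just (w , d)) step) | reads-just v k s∈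
    ...   | inj₁ (refl , d≡k+1) | P , path , P-label = P , path , (begin
            pathLabel g P ++ take (suc (toℕ d)) (label v)
              ≡⟨ cong (pathLabel g P ++_) (take-step v d _ c d≡k+1 (step-char (just (v , k)) c v d step)) ⟩
            pathLabel g P ++ (take (suc (toℕ k)) (label v) ++ c ∷ [])
              ≡⟨ List.++-assoc (pathLabel g P) _ _ ⟨
            (pathLabel g P ++ take (suc (toℕ k)) (label v)) ∷ʳ c
              ≡⟨ cong (_∷ʳ c) P-label ⟩
            x ∷ʳ c ∎)
    ...   | inj₂ (end , vw , d≡0) | P , path , P-label = P ∷ʳ v , isPath-∷ʳ P v w path vw , (begin
            pathLabel g (P ∷ʳ v) ++ take (suc (toℕ d)) (label w)
              ≡⟨ cong₂ _++_ (pathLabel-∷ʳ P v) (take-step w d 0 c d≡0 (step-char (just (v , k)) c w d step)) ⟩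
            (pathLabel g P ++ label v) ∷ʳ c
              ≡⟨ cong (λ ys → (pathLabel g P ++ ys) ∷ʳ c) (take-last v k end) ⟨
            (pathLabel g P ++ take (suc (toℕ k)) (label v)) ∷ʳ c
              ≡⟨ cong (_∷ʳ c) P-label ⟩
            x ∷ʳ c ∎)

  reads-δ* : ∀ x y S → Reads y S → Reads (y ++ x) (foldl (δ g) S x)
  reads-δ* [] y S p = subst (λ z → Reads z S) (sym (List.++-identityʳ y)) p
  reads-δ* (c ∷ x) y S p = subst (λ z → Reads z (foldl (δ g) (δ g S c) x)) (List.++-assoc y (c ∷ []) x) (reads-δ* x (y ∷ʳ c) (δ g S c) (reads-δ y S c p))

  reads-initial : Reads [] (initialD g)
  reads-initial = (λ _ → refl) , (λ w d m → contradiction (∈initial⁻ _ m) λ ())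

  reads-reachable : ∀ x → Reads x (δ* g (initialD g) x)
  reads-reachable x = reads-δ* x [] (initialD g) reads-initial

  length-pathLabel-++ : ∀ P Q → length (pathLabel g (P ++ Q)) ≡ length (pathLabel g P) + length (pathLabel g Q)
  length-pathLabel-++ P Q = trans (cong length (List.concatMap-++ label P Q)) (List.length-++ (pathLabel g P))

  length-pathLabel-∷ʳ : ∀ P v → length (pathLabel g (P ∷ʳ v)) ≡ length (pathLabel g P) + len g v
  length-pathLabel-∷ʳ P v = trans (cong length (pathLabel-∷ʳ P v)) (List.length-++ (pathLabel g P))

  atEndD-true⁻ : ∀ S → atEndD g S ≡ true → ∃[ t ] t ∈ˢ S × atEnd g t ≡ true
  atEndD-true⁻ S e with any-true⁻ _ (zip (states g) S) e
  ... | (t , true) , m , h = t , m , h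

  atEndD-false : ∀ S t → atEndD g S ≡ false → t ∈ˢ S → atEnd g t ≡ false
  atEndD-false S t e m with atEnd g t in h
  ... | false = refl
  ... | true with () ← trans (sym (any-true⁺ (λ p → proj₂ p ∧ atEnd g (proj₁ p)) (zip (states g) S) (t , true) m h)) e

  atEndD-true⁺ : ∀ S t → t ∈ˢ S → atEnd g t ≡ true → atEndD g S ≡ true
  atEndD-true⁺ S t m h = any-true⁺ (λ p → proj₂ p ∧ atEnd g (proj₁ p)) (zip (states g) S) (t , true) m h

  EndOf : Fin n → DState g → Set
  EndOf u S = Σ (Fin (len g u)) λ ku → just (u , ku) ∈ˢ S × atEnd g (just (u , ku)) ≡ true × (∀ t → t ∈ˢ S → t ≡ just (u , ku))

  Uniform : List (Fin σ) → DState g → Set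
  Uniform p S = ∀ t → t ∈ˢ S → Σ (Fin n) λ w → Σ (Fin (len g w)) λ d → t ≡ just (w , d) × atEnd g t ≡ false × take (suc (toℕ d)) (label w) ≡ p

  InitialOnly : DState g → Set
  InitialOnly S = ∀ t → t ∈ˢ S → t ≡ nothing

  Shape : DState g → Set
  Shape S = InitialOnly S ⊎ (Σ (Fin n) λ u → EndOf u S) ⊎ (Σ (List (Fin σ)) λ p → Uniform p S)

  no-state-after-end : ∀ v (k : Fin (len g v)) → atEnd g (just (v , k)) ≡ true → ∀ (d : Fin (len g v)) → toℕ d ≢ suc (toℕ k)
  no-state-after-end v k end d eq = <⇒≢ (Fin.toℕ<n d) (trans eq (atEnd⇒last v k end))

  AtBoundary : NState g → Set
  AtBoundary s = s ≡ nothing ⊎ atEnd g s ≡ true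

  step-cases : ∀ s c w d → nfaStep g s c (just (w , d)) ≡ true →
    toℕ d ≡ 0 ⊎ Σ (Fin (len g w)) λ k → s ≡ just (w , k) × toℕ d ≡ suc (toℕ k)
  step-cases nothing c w d step = inj₁ (proj₁ (arc-from-initial w d (step-arc nothing c (just (w , d)) step)))
  step-cases (just (v , k)) c w d step with arc-from-state v k w d (step-arc (just (v , k)) c (just (w , d)) step)
  ... | inj₁ (refl , eq) = inj₂ (k , refl , eq)
  ... | inj₂ (_ , _ , d≡0) = inj₁ d≡0

  step-from-boundary : ∀ s c w d → AtBoundary s → nfaStep g s c (just (w , d)) ≡ true → toℕ d ≡ 0
  step-from-boundary s c w d boundary step with step-cases s c w d step
  ... | inj₁ d≡0 = d≡0
  ... | inj₂ (k , refl , eq) with boundary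
  ...   | inj₂ end = contradiction eq (no-state-after-end w k end d)

  uniform-after-boundary : ∀ S c → (∀ s → s ∈ˢ S → AtBoundary s) → atEndD g (δ g S c) ≡ false → Uniform (c ∷ []) (δ g S c)
  uniform-after-boundary S c boundary not-end nothing t∈ = contradiction t∈ (nothing∉δ S c)
  uniform-after-boundary S c boundary not-end (just (w , d)) t∈ with ∈δ⁻ S c (just (w , d)) t∈
  ... | s , s∈ , step = w , d , refl , atEndD-false (δ g S c) (just (w , d)) not-end t∈ ,
    take-step w d 0 c (step-from-boundary s c w d (boundary s s∈) step) (step-char s c w d step)

  uniform-δ : ∀ S c p → Uniform p S → atEndD g (δ g S c) ≡ false → Uniform (p ∷ʳ c) (δ g S c)
  uniform-δ S c p U not-end nothing t∈ = contradiction t∈ (nothing∉δ S c)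
  uniform-δ S c p U not-end (just (w , d)) t∈ with ∈δ⁻ S c (just (w , d)) t∈
  ... | s , s∈ , step with U s s∈
  ...   | v , k , refl , v-not-end , prefix with arc-from-state v k w d (step-arc (just (v , k)) c (just (w , d)) step)
  ...     | inj₂ (end , _ , _) with () ← trans (sym v-not-end) end
  ...     | inj₁ (refl , eq) = v , d , refl , atEndD-false (δ g S c) (just (v , d)) not-end t∈ ,
               trans (take-step v d _ c eq (step-char (just (v , k)) c v d step)) (cong (_∷ʳ c) prefix)

  module RepeatFreeness (rf : RepeatFree g) where

    occurrence-in-last : ∀ u Q w xs r → IsPath g (Q ∷ʳ w) → length r < len g w →
      pathLabel g (Q ∷ʳ w) ≡ xs ++ label u ++ r → u ≡ w × length r ≡ 0
    -- Repeat-freeness splits the path as P₁ ++ u ∷ P₂ with ℓ(P₂) of length |r| < |ℓ(w)|,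
    -- so P₂ cannot end with w and must be empty.
    occurrence-in-last u Q w xs r path r<w eq with rf u (Q ∷ʳ w) path xs r eq
    ... | P₁ , P₂ , split , P₁-label = go (initLast P₂) split length-P₂
      where
      length-P₂ : length (pathLabel g P₂) ≡ length r
      length-P₂ = +-cancelˡ-≡ (length xs + len g u) _ _ (begin
          length xs + len g u + length (pathLabel g P₂)
            ≡⟨ cong (λ ys → length ys + len g u + length (pathLabel g P₂)) (sym P₁-label) ⟩
          length (pathLabel g P₁) + len g u + length (pathLabel g P₂)
            ≡⟨ +-assoc (length (pathLabel g P₁)) _ _ ⟩
          length (pathLabel g P₁) + (len g u + length (pathLabel g P₂))
            ≡⟨ trans (cong (length (pathLabel g P₁) +_) (sym (List.length-++ (label u) {pathLabel g P₂}))) (sym (length-pathLabel-++ P₁ (u ∷ P₂))) ⟩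
          length (pathLabel g (P₁ ++ u ∷ P₂))
            ≡⟨ cong (length ∘ pathLabel g) (sym split) ⟩
          length (pathLabel g (Q ∷ʳ w))
            ≡⟨ cong length eq ⟩
          length (xs ++ label u ++ r)
            ≡⟨ trans (List.length-++ xs) (cong (length xs +_) (List.length-++ (label u))) ⟩
          length xs + (len g u + length r)
            ≡⟨ sym (+-assoc (length xs) _ _) ⟩
          length xs + len g u + length r ∎)
        where open ≡-Reasoning
      go : ∀ {P₂} → InitLast P₂ → Q ∷ʳ w ≡ P₁ ++ u ∷ P₂ → length (pathLabel g P₂) ≡ length r → u ≡ w × length r ≡ 0
      go [] split′ lengths with List.∷ʳ-injective Q P₁ split′
      ... | _ , w≡u = sym w≡u , sym lengths
      go (P₂′ ∷ʳ′ z) split′ lengths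
        with List.∷ʳ-injective Q (P₁ ++ u ∷ P₂′) (trans split′ (sym (List.++-assoc P₁ (u ∷ P₂′) (z ∷ []))))
      ... | _ , refl = contradiction (≤-trans (m≤n+m (len g w) _) (≤-reflexive (trans (sym (length-pathLabel-∷ʳ P₂′ w)) lengths))) (<⇒≱ r<w)

    end-state-alone : ∀ x S → Reads x S → ∀ u (ku : Fin (len g u)) → just (u , ku) ∈ˢ S → atEnd g (just (u , ku)) ≡ true →
                      ∀ t → t ∈ˢ S → t ≡ just (u , ku)
    end-state-alone x S (reads-nothing , reads-just) u ku ∈S end t t∈S with reads-just u ku ∈S
    ... | Pe , _ , Pe-label with t
    ...   | nothing = ⊥-elim (non-empty (pathLabel g Pe)
                          (trans (cong (pathLabel g Pe ++_) (sym (take-last u ku end))) (trans Pe-label (reads-nothing t∈S))))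
      where
      non-empty : ∀ ys → ys ++ label u ≢ []
      non-empty [] ()
      non-empty (_ ∷ _) ()
    ...   | just (w , d) with reads-just w d t∈S
    ...     | Pt , Pt-path , Pt-label with occurrence-in-last u Pt w (pathLabel g Pe) rest Pt-path rest<w pathLabel-Pt∷w
      where
      rest = drop (suc (toℕ d)) (label w)
      rest<w : length rest < len g w
      rest<w = ≤-trans (≤-reflexive (cong suc (List.length-drop (suc (toℕ d)) (label w)))) (s≤s (m∸n≤m _ (toℕ d)))
      pathLabel-Pt∷w : pathLabel g (Pt ∷ʳ w) ≡ pathLabel g Pe ++ label u ++ rest
      pathLabel-Pt∷w = begin
        pathLabel g (Pt ∷ʳ w)                                       ≡⟨ pathLabel-∷ʳ Pt w ⟩
        pathLabel g Pt ++ label w                                   ≡⟨ cong (pathLabel g Pt ++_) (sym (List.take++drop≡id (suc (toℕ d)) (label w))) ⟩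
        pathLabel g Pt ++ (take (suc (toℕ d)) (label w) ++ rest)    ≡⟨ sym (List.++-assoc (pathLabel g Pt) _ _) ⟩
        (pathLabel g Pt ++ take (suc (toℕ d)) (label w)) ++ rest    ≡⟨ cong (_++ rest) (trans Pt-label (sym Pe-label)) ⟩
        (pathLabel g Pe ++ take (suc (toℕ ku)) (label u)) ++ rest   ≡⟨ cong (λ ys → (pathLabel g Pe ++ ys) ++ rest) (take-last u ku end) ⟩
        (pathLabel g Pe ++ label u) ++ rest                         ≡⟨ List.++-assoc (pathLabel g Pe) _ _ ⟩
        pathLabel g Pe ++ label u ++ rest                           ∎
        where open ≡-Reasoning
    ...       | refl , rest-empty = cong (λ k → just (u , k)) (Fin.toℕ-injective (suc-injective (trans (≤-antisym (Fin.toℕ<n d) d-last) (sym (atEnd⇒last u ku end)))))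
      where
      d-last : len g u ≤ suc (toℕ d)
      d-last = m∸n≡0⇒m≤n (trans (sym (List.length-drop (suc (toℕ d)) (label u))) rest-empty)

    shape-δ : ∀ x S c → Reads x S → Shape S → Shape (δ g S c)
    shape-δ x S c reads shape with atEndD g (δ g S c) in end
    ... | true with atEndD-true⁻ (δ g S c) end
    ...   | just (u , ku) , u∈ , u-end = inj₂ (inj₁ (u , ku , u∈ , u-end , end-state-alone (x ∷ʳ c) (δ g S c) (reads-δ x S c reads) u ku u∈ u-end))
    shape-δ x S c reads (inj₁ initial) | false = inj₂ (inj₂ (c ∷ [] , uniform-after-boundary S c (λ s s∈ → inj₁ (initial s s∈)) end))
    shape-δ x S c reads (inj₂ (inj₁ (u , ku , u∈ , u-end , alone))) | false =
      inj₂ (inj₂ (c ∷ [] , uniform-after-boundary S c (λ s s∈ → inj₂ (subst (λ t → atEnd g t ≡ true) (sym (alone s s∈)) u-end)) end))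
    shape-δ x S c reads (inj₂ (inj₂ (p , U))) | false = inj₂ (inj₂ (p ∷ʳ c , uniform-δ S c p U end))

    shape-δ* : ∀ x y S → Reads y S → Shape S → Shape (foldl (δ g) S x)
    shape-δ* [] y S reads shape = shape
    shape-δ* (c ∷ x) y S reads shape = shape-δ* x (y ∷ʳ c) (δ g S c) (reads-δ y S c reads) (shape-δ y S c reads shape)

    shape-reachable : ∀ x → Shape (δ* g (initialD g) x)
    shape-reachable x = shape-δ* x [] (initialD g) reads-initial (inj₁ ∈initial⁻)

  EntersFrom : DState g → Fin n → Set
  EntersFrom K w = ∃[ s ] s ∈ˢ K × Σ (Fin (len g w)) λ d₀ → toℕ d₀ ≡ 0 × nfaArc g s (just (w , d₀)) ≡ true

  -- The invariant after reading j + 1 letters from a set K of boundary states.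
  DepthBound : DState g → ℕ → DState g → Set
  DepthBound K j T = ∀ w d → just (w , d) ∈ˢ T → toℕ d ≤ j × (toℕ d ≡ j → EntersFrom K w)

  depth-first : ∀ K c → (∀ s → s ∈ˢ K → AtBoundary s) → DepthBound K 0 (δ g K c)
  depth-first K c boundary w d t∈ with ∈δ⁻ K c (just (w , d)) t∈
  ... | s , s∈ , step = ≤-reflexive d≡0 , (λ _ → s , s∈ , d , d≡0 , step-arc s c (just (w , d)) step)
    where
    d≡0 = step-from-boundary s c w d (boundary s s∈) step

  depth-δ : ∀ K j T c → DepthBound K j T → DepthBound K (suc j) (δ g T c)
  depth-δ K j T c bound w d t∈ with ∈δ⁻ T c (just (w , d)) t∈
  ... | s , s∈ , step with step-cases s c w d step
  ...   | inj₁ d≡0 = ≤-trans (≤-reflexive d≡0) z≤n , (λ e → contradiction (trans (sym d≡0) e) 0≢1+n)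
  ...   | inj₂ (k , refl , eq) with bound w k s∈
  ...     | k≤j , at-j = ≤-trans (≤-reflexive eq) (s≤s k≤j) , (λ e → at-j (suc-injective (trans (sym eq) e)))

  depth-δ* : ∀ K j T p → DepthBound K j T → DepthBound K (j + length p) (foldl (δ g) T p)
  depth-δ* K j T [] bound = subst (λ i → DepthBound K i T) (sym (+-identityʳ j)) bound
  depth-δ* K j T (c ∷ p) bound = subst (λ i → DepthBound K i (foldl (δ g) (δ g T c) p)) (sym (+-suc j (length p)))
                                       (depth-δ* K (suc j) (δ g T c) p (depth-δ K j T c bound))

  entersFrom-prefix : ∀ K w d → (∀ s → s ∈ˢ K → AtBoundary s) →
    just (w , d) ∈ˢ δ* g K (take (suc (toℕ d)) (label w)) → EntersFrom K w
  entersFrom-prefix K w d boundary = go (take (suc (toℕ d)) (label w)) length-prefix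
    where
    length-prefix : length (take (suc (toℕ d)) (label w)) ≡ suc (toℕ d)
    length-prefix = trans (List.length-take (suc (toℕ d)) (label w)) (m≤n⇒m⊓n≡m (Fin.toℕ<n d))
    go : ∀ p → length p ≡ suc (toℕ d) → just (w , d) ∈ˢ δ* g K p → EntersFrom K w
    go (c ∷ q) length-p t∈ = proj₂ (depth-δ* K 0 (δ g K c) q (depth-first K c boundary) w d t∈) (sym (suc-injective length-p))

  firstMember : List (NState g × Bool) → Maybe (NState g)
  firstMember [] = nothing
  firstMember ((t , true) ∷ r) = just t
  firstMember ((t , false) ∷ r) = firstMember r

  firstMember-∈ : ∀ zs t → firstMember zs ≡ just t → (t , true) ∈ zs
  firstMember-∈ ((t′ , true) ∷ zs) t refl = here refl
  firstMember-∈ ((t′ , false) ∷ zs) t e = there (firstMember-∈ zs t e)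

  firstMember-exists : ∀ zs t → (t , true) ∈ zs → ∃[ t′ ] firstMember zs ≡ just t′
  firstMember-exists ((t′ , true) ∷ zs) t _ = t′ , refl
  firstMember-exists ((t′ , false) ∷ zs) t (here ())
  firstMember-exists ((t′ , false) ∷ zs) t (there m) = firstMember-exists zs t m

  firstState : DState g → Maybe (NState g)
  firstState S = firstMember (zip (states g) S)

  prefixOfState : Maybe (NState g) → List (Fin σ)
  prefixOfState (just (just (w , d))) = take (suc (toℕ d)) (label w)
  prefixOfState _ = []

  nodeOfState : Maybe (NState g) → Maybe (Fin n)
  nodeOfState (just (just (v , _))) = just v
  nodeOfState _ = nothing

  prefixOf : DState g → List (Fin σ)
  prefixOf S = prefixOfState (firstState S)

  firstNode : DState g → Maybe (Fin n)
  firstNode S = nodeOfState (firstState S)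

  firstState-∈ : ∀ S t → t ∈ˢ S → Σ (NState g) λ t′ → firstState S ≡ just t′ × t′ ∈ˢ S
  firstState-∈ S t m with firstMember-exists (zip (states g) S) t m
  ... | t′ , e = t′ , e , firstMember-∈ (zip (states g) S) t′ e

  prefixOf-uniform : ∀ p S t → Uniform p S → t ∈ˢ S → prefixOf S ≡ p
  prefixOf-uniform p S t U m with firstState-∈ S t m
  ... | t′ , e , m′ with U t′ m′
  ... | w , d , refl , _ , tk rewrite e = tk

  firstNode-endOf : ∀ u S → EndOf u S → firstNode S ≡ just u
  firstNode-endOf u S (ku , m , en , all) with firstState-∈ S _ m
  ... | t′ , e , m′ rewrite e | all t′ m′ = refl

  firstNode-initialOnly : ∀ S t → InitialOnly S → t ∈ˢ S → firstNode S ≡ nothing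
  firstNode-initialOnly S t il m with firstState-∈ S t m
  ... | t′ , e , m′ rewrite e | il t′ m′ = refl

  Tabulated : DState g → Set
  Tabulated S = ∃[ h ] S ≡ map h (states g)

  tabulated-δ* : ∀ x S → Tabulated S → Tabulated (foldl (δ g) S x)
  tabulated-δ* [] S mf = mf
  tabulated-δ* (c ∷ x) S mf = tabulated-δ* x (δ g S c) (δ-bit S c , refl)

  tabulated-reachable : ∀ x → Tabulated (δ* g (initialD g) x)
  tabulated-reachable x = tabulated-δ* x (initialD g) (_ , refl)

  ∈ˢ-tabulate⁺ : ∀ h t → h t ≡ true → t ∈ˢ map h (states g)
  ∈ˢ-tabulate⁺ h t e = subst (λ b → (t , b) ∈ zip (states g) (map h (states g))) e (∈-zip-map⁺ h (states g) t (∈-states t))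

  ∈ˢ-tabulate⁻ : ∀ h t → t ∈ˢ map h (states g) → h t ≡ true
  ∈ˢ-tabulate⁻ h t t∈ = sym (proj₂ (∈-zip-map⁻ h (states g) t true t∈))

  nonempty⇒∈ : ∀ S → Tabulated S → NonemptyD g S → ∃[ t ] t ∈ˢ S
  nonempty⇒∈ S (h , refl) nonempty with any-true⁻ (λ b → b) (map h (states g)) nonempty
  ... | b , b∈ , refl with ∈-map⁻ h b∈
  ...   | t , _ , e = t , ∈ˢ-tabulate⁺ h t (sym e)

  ∈⇒nonempty : ∀ S t → t ∈ˢ S → NonemptyD g S
  ∈⇒nonempty S t t∈ = any-true⁺ (λ b → b) S true (∈-zip⁻ʳ (states g) S t∈) refl

  ∈ˢ-extensional : ∀ S S′ → Tabulated S → Tabulated S′ → (∀ t → t ∈ˢ S → t ∈ˢ S′) → (∀ t → t ∈ˢ S′ → t ∈ˢ S) → S ≡ S′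
  ∈ˢ-extensional S S′ (h , refl) (h′ , refl) to from = List.map-cong pointwise (states g)
    where
    pointwise : ∀ t → h t ≡ h′ t
    pointwise t with h t in e | h′ t in e′
    ... | false | false = refl
    ... | true | true = refl
    ... | true | false = contradiction (trans (sym (∈ˢ-tabulate⁻ h′ t (to t (∈ˢ-tabulate⁺ h t e)))) e′) λ ()
    ... | false | true = contradiction (trans (sym (∈ˢ-tabulate⁻ h t (from t (∈ˢ-tabulate⁺ h′ t e′)))) e) λ ()

module Expansion {σ : ℕ} (g : EBG σ) (ord : List (DState g)) where

  open Counting
  open import Data.Nat using (ℕ; zero; suc; _+_; _*_; _≤_; _<_; z≤n; s≤s; _≡ᵇ_; _≟_; _<?_; _≤?_)
  open import Data.Nat.Properties
  open import Data.Bool using (Bool; true; false; _∧_; _∨_; not; if_then_else_)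
  import Data.Bool as Bool
  open import Data.Bool.Properties using (∧-zeroʳ; ∧-identityʳ; ∨-zeroʳ; ∧-conicalˡ; ∧-conicalʳ)
  open import Data.List using (List; []; _∷_; _++_; map; concatMap; filter; length; applyUpTo; upTo; zip; allFin)
  import Data.List.Properties as List
  open import Data.Fin using (Fin)
  open import Data.Product using (_×_; _,_; proj₁; proj₂)
  open import Relation.Nullary using (does; yes; no; contradiction)
  open import Relation.Nullary.Decidable using (dec-true; dec-false)
  open import Relation.Binary.PropositionalEquality
  open import Data.List.Membership.Propositional using (_∈_)
  open import Data.List.Relation.Unary.Any using (here; there)
  open import Function using (_∘_)

  L : ℕ
  L = length ord

  -- [] is a junk value: nth is only used below the length of the list.
  nth : List (DState g) → ℕ → DState g
  nth [] i = []
  nth (S ∷ Ss) zero = S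
  nth (S ∷ Ss) (suc i) = nth Ss i

  stateAt : ℕ → DState g
  stateAt = nth ord

  mult : ℕ → ℕ → ℕ
  mult i j = count (λ c → eqD g (δ g (stateAt i) c) (stateAt j)) (allFin σ)

  keptAt : ℕ → Bool
  keptAt i = kept g (stateAt i)

  -- copies t bounds the number of nodes that replace node t of G, and
  -- inflow t j the number of edges into j from the copies of the nodes i < t.
  mutual
    copies : ℕ → ℕ
    copies t = if keptAt t then 1 else inflow t t

    inflow : ℕ → ℕ → ℕ
    inflow zero j = 0
    inflow (suc t) j = inflow t j + mult t j * copies t

  inflow≡∑ : ∀ t j → inflow t j ≡ ∑[ i ∈ upTo t ] (mult i j * copies i)
  inflow≡∑ zero j = refl
  inflow≡∑ (suc t) j = trans (cong (_+ mult t j * copies t) (inflow≡∑ t j))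
                             (sym (∑-upTo-suc t (λ i → mult i j * copies i)))

  newNodes : ℕ → ℕ
  newNodes t = ∑[ i ∈ upTo t ] (if keptAt i then 0 else copies i)

  Edge : Set
  Edge = ℕ × ℕ × Fin σ

  src dst : Edge → ℕ
  src e = proj₁ e
  dst e = proj₁ (proj₂ e)

  edgeFromTo : ℕ → ℕ → Edge → Bool
  edgeFromTo i j e = (src e ≡ᵇ i) ∧ (dst e ≡ᵇ j)

  -- The source of the edge is a node of G processed before t, or a node created by an expansion.
  fromDone : ℕ → Edge → Bool
  fromDone t e = does (src e <? t) ∨ does (L ≤? src e)

  fromDone-< : ∀ t e → src e < t → fromDone t e ≡ true
  fromDone-< t e lt = cong (_∨ does (L ≤? src e)) (dec-true (src e <? t) lt)

  fromDone-≥L : ∀ t e → L ≤ src e → fromDone t e ≡ true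
  fromDone-≥L t e le = trans (cong (does (src e <? t) ∨_) (dec-true (L ≤? src e) le)) (∨-zeroʳ _)

  fromDone-pending : ∀ t e → t ≤ src e → src e < L → fromDone t e ≡ false
  fromDone-pending t e le lt = cong₂ _∨_ (dec-false (src e <? t) (≤⇒≯ le)) (dec-false (L ≤? src e) (<⇒≱ lt))

  fromDone-suc : ∀ t e → fromDone (suc t) e ≡ true → src e ≢ t → fromDone t e ≡ true
  fromDone-suc t e done ne with src e <? t | L ≤? src e
  ... | yes lt | _ = fromDone-< t e lt
  ... | _ | yes ge = fromDone-≥L t e ge
  ... | no nlt | no nge =
    contradiction (trans (sym done) (fromDone-pending (suc t) e (≤∧≢⇒< (≮⇒≥ nlt) (ne ∘ sym)) (≰⇒> nge))) λ ()

  record Invariant (t : ℕ) (G : Graph g) : Set where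
    field
      fresh-≥ : L ≤ Graph.fresh G
      pending-edges : ∀ i j → t ≤ i → i < L → j < L → count (edgeFromTo i j) (Graph.edges G) ≡ mult i j
      inflow-bound : ∀ j → t ≤ j → j < L → count (λ e → (dst e ≡ᵇ j) ∧ fromDone t e) (Graph.edges G) ≤ inflow t j
      node-count : length (Graph.nodes G) ≤ L + newNodes t

  newNodes-suc : ∀ t → newNodes (suc t) ≡ newNodes t + (if keptAt t then 0 else copies t)
  newNodes-suc t = ∑-upTo-suc t (λ i → if keptAt i then 0 else copies i)

  enumerate : ℕ → List (DState g) → List (ℕ × DState g)
  enumerate t [] = []
  enumerate t (S ∷ Ss) = (t , S) ∷ enumerate (suc t) Ss

  zip-applyUpTo≡enumerate : ∀ t Ss → zip (applyUpTo (t +_) (length Ss)) Ss ≡ enumerate t Ss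
  zip-applyUpTo≡enumerate t [] = refl
  zip-applyUpTo≡enumerate t (S ∷ Ss) = cong₂ _∷_ (cong (_, S) (+-identityʳ t))
    (trans (cong (λ ns → zip ns Ss) (applyUpTo-cong (length Ss) (+-suc t)))
           (zip-applyUpTo≡enumerate (suc t) Ss))

  indexed≡enumerate : indexed g ord ≡ enumerate 0 ord
  indexed≡enumerate = zip-applyUpTo≡enumerate 0 ord

  enumerate-index< : ∀ t Ss {p} → p ∈ enumerate t Ss → proj₁ p < t + length Ss
  enumerate-index< t (S ∷ Ss) (here refl) = m<m+n t (s≤s z≤n)
  enumerate-index< t (S ∷ Ss) (there p∈) = ≤-trans (enumerate-index< (suc t) Ss p∈) (≤-reflexive (sym (+-suc t (length Ss))))

  enumerate-index≥ : ∀ t Ss {p} → p ∈ enumerate t Ss → t ≤ proj₁ p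
  enumerate-index≥ t (S ∷ Ss) (here refl) = ≤-refl
  enumerate-index≥ t (S ∷ Ss) (there p∈) = <⇒≤ (enumerate-index≥ (suc t) Ss p∈)

  ∑-enumerate-select : ∀ t Ss k (H : DState g → ℕ) → k < length Ss →
    ∑[ p ∈ enumerate t Ss ] (if proj₁ p ≡ᵇ t + k then H (proj₂ p) else 0) ≡ H (nth Ss k)
  ∑-enumerate-select t (S ∷ Ss) zero H _ rewrite +-identityʳ t | ≡ᵇ-refl t =
    trans (cong (H S +_) (∑-zero (enumerate (suc t) Ss) later)) (+-identityʳ _)
    where
    later : ∀ p → p ∈ enumerate (suc t) Ss → (if proj₁ p ≡ᵇ t then H (proj₂ p) else 0) ≡ 0
    later p p∈ rewrite ≡ᵇ-false (proj₁ p) t (>⇒≢ (enumerate-index≥ (suc t) Ss p∈)) = refl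
  ∑-enumerate-select t (S ∷ Ss) (suc k) H (s≤s k<) rewrite ≡ᵇ-false t (t + suc k) (λ e → m≢1+m+n t (trans e (+-suc t k))) | +-suc t k =
    ∑-enumerate-select (suc t) Ss k H k<

  edgesOf : List (ℕ × DState g) → List Edge
  edgesOf I = concatMap (λ p → concatMap (λ q → concatMap
    (λ c → if eqD g (δ g (proj₂ p) c) (proj₂ q) then (proj₁ p , proj₁ q , c) ∷ [] else [])
    (allFin σ)) I) I

  count-edgesOf : ∀ (φ : Edge → Bool) I → count φ (edgesOf I) ≡
    ∑[ p ∈ I ] ∑[ q ∈ I ] ∑[ c ∈ allFin σ ] 𝟙 (eqD g (δ g (proj₂ p) c) (proj₂ q) ∧ φ (proj₁ p , proj₁ q , c))
  count-edgesOf φ I =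
    trans (∑-concatMap _ I _) (∑-cong I (λ p _ →
    trans (∑-concatMap _ I _) (∑-cong I (λ q _ →
    trans (∑-concatMap _ (allFin σ) _) (∑-cong (allFin σ) (λ c _ → count-singleton _ _))))))
    where
    count-singleton : ∀ b e → count φ (if b then e ∷ [] else []) ≡ 𝟙 (b ∧ φ e)
    count-singleton true e = +-identityʳ _
    count-singleton false e = refl

  module _ (acyclic : ∀ i j → j ≤ i → i < L → mult i j ≡ 0) where

    indegree≤inflow : ∀ t es → t < L →
      (∀ i j → t ≤ i → i < L → j < L → count (edgeFromTo i j) es ≡ mult i j) →
      count (λ e → dst e ≡ᵇ t) es ≤ count (λ e → (dst e ≡ᵇ t) ∧ fromDone t e) es
    indegree≤inflow t es t<L pending = count-mono _ _ es done
      where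
      done : ∀ e → e ∈ es → (dst e ≡ᵇ t) ≡ true → ((dst e ≡ᵇ t) ∧ fromDone t e) ≡ true
      done e e∈ d with src e <? t | L ≤? src e
      ... | yes lt | _ = cong₂ _∧_ d (fromDone-< t e lt)
      ... | _ | yes ge = cong₂ _∧_ d (fromDone-≥L t e ge)
      ... | no nlt | no nge = contradiction (subst (1 ≤_) no-edges (count-pos _ es e∈ (cong₂ _∧_ (≡ᵇ-refl (src e)) d))) λ ()
        where
        no-edges : count (edgeFromTo (src e) t) es ≡ 0
        no-edges = trans (pending (src e) t (≮⇒≥ nlt) (≰⇒> nge) t<L) (acyclic (src e) t (≮⇒≥ nlt) (≰⇒> nge))

    invariant-kept : ∀ t G → keptAt t ≡ true → t < L → Invariant t G → Invariant (suc t) G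
    invariant-kept t G k t<L I = record
      { fresh-≥ = fresh-≥
      ; pending-edges = λ i j ti → pending-edges i j (<⇒≤ ti)
      ; inflow-bound = λ j tj jL → begin
          count (λ e → (dst e ≡ᵇ j) ∧ fromDone (suc t) e) edges
            ≤⟨ count-∨ _ _ _ edges (done-or-from-t j) ⟩
          count (λ e → (dst e ≡ᵇ j) ∧ fromDone t e) edges + count (edgeFromTo t j) edges
            ≤⟨ +-mono-≤ (inflow-bound j (<⇒≤ tj) jL) (≤-reflexive (pending-edges t j ≤-refl t<L jL)) ⟩
          inflow t j + mult t j
            ≡⟨ cong (inflow t j +_) (sym (trans (cong (mult t j *_) one-copy) (*-identityʳ (mult t j)))) ⟩
          inflow (suc t) j ∎
      ; node-count = ≤-trans node-count (≤-reflexive (cong (L +_) (sym no-new-nodes)))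
      }
      where
      open Invariant I
      open Graph G using (edges)
      open ≤-Reasoning
      one-copy : copies t ≡ 1
      one-copy rewrite k = refl
      no-new-nodes : newNodes (suc t) ≡ newNodes t
      no-new-nodes rewrite newNodes-suc t | k = +-identityʳ (newNodes t)
      done-or-from-t : ∀ j e → e ∈ edges → ((dst e ≡ᵇ j) ∧ fromDone (suc t) e) ≡ true →
        (((dst e ≡ᵇ j) ∧ fromDone t e) ∨ edgeFromTo t j e) ≡ true
      done-or-from-t j e _ h with dst e ≡ᵇ j
      ... | true with src e ≟ t
      ...   | yes refl rewrite ≡ᵇ-refl (src e) = ∨-zeroʳ (fromDone (src e) e)
      ...   | no ne rewrite fromDone-suc t e h ne = refl

    module Expand (t : ℕ) (ns : List ℕ) (es : List Edge) (f : ℕ)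
                  (t<L : t < L) (not-kept : keptAt t ≡ false) (I : Invariant t (graph ns es f)) where
      open Invariant I

      ins : List (ℕ × Fin σ)
      ins = map (λ e → src e , proj₂ (proj₂ e)) (filter (λ e → dst e ≟ t) es)

      outs : List (ℕ × Fin σ)
      outs = map (λ e → dst e , proj₂ (proj₂ e)) (filter (λ e → src e ≟ t) es)

      rest : List Edge
      rest = filter (λ e → not ((src e ≡ᵇ t) ∨ (dst e ≡ᵇ t)) Bool.≟ true) es

      numbered-ins : List (ℕ × ℕ × Fin σ)
      numbered-ins = zip (upTo (length ins)) ins

      edgesOfCopy : ℕ × ℕ × Fin σ → List Edge
      edgesOfCopy p = (proj₁ (proj₂ p) , f + proj₁ p , proj₂ (proj₂ p)) ∷
                      map (λ o → f + proj₁ p , proj₁ o , proj₂ o) outs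

      new : List Edge
      new = concatMap edgesOfCopy numbered-ins

      count-rest : ∀ (φ : Edge → Bool) → count φ rest ≡ count (λ e → not ((src e ≡ᵇ t) ∨ (dst e ≡ᵇ t)) ∧ φ e) es
      count-rest φ = trans (count-filter _ φ es) (∑-cong es (λ e _ → cong (λ b → 𝟙 (b ∧ φ e)) (does-≟true _)))

      count-new : ∀ (φ : Edge → Bool) → count φ new ≡
        ∑[ p ∈ numbered-ins ] (𝟙 (φ (proj₁ (proj₂ p) , f + proj₁ p , proj₂ (proj₂ p))) +
                               count (λ o → φ (f + proj₁ p , proj₁ o , proj₂ o)) outs)
      count-new φ = trans (∑-concatMap edgesOfCopy numbered-ins (𝟙 ∘ φ))
        (∑-cong numbered-ins (λ p _ → cong (𝟙 (φ (proj₁ (proj₂ p) , f + proj₁ p , proj₂ (proj₂ p))) +_)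
                                           (∑-map (λ o → f + proj₁ p , proj₁ o , proj₂ o) outs (𝟙 ∘ φ))))

      fresh≢ : ∀ k j → j < L → f + k ≢ j
      fresh≢ k j jL e = <⇒≱ jL (≤-trans fresh-≥ (≤-trans (m≤m+n f k) (≤-reflexive e)))

      length-ins≤copies : length ins ≤ copies t
      length-ins≤copies = begin
        length ins                                            ≡⟨ List.length-map _ (filter (λ e → dst e ≟ t) es) ⟩
        length (filter (λ e → dst e ≟ t) es)                  ≡⟨ length-filter≡count (λ e → dst e ≟ t) es ⟩
        count (λ e → dst e ≡ᵇ t) es                           ≤⟨ indegree≤inflow t es t<L pending-edges ⟩
        count (λ e → (dst e ≡ᵇ t) ∧ fromDone t e) es         ≤⟨ inflow-bound t ≤-refl t<L ⟩
        inflow t t                                            ≡⟨ cong (if_then 1 else inflow t t) (sym not-kept) ⟩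
        copies t                                              ∎
        where open ≤-Reasoning

      count-outs : ∀ j → j < L → count (λ o → proj₁ o ≡ᵇ j) outs ≡ mult t j
      count-outs j jL = begin
        count (λ o → proj₁ o ≡ᵇ j) outs                         ≡⟨ ∑-map _ (filter (λ e → src e ≟ t) es) _ ⟩
        count (λ e → dst e ≡ᵇ j) (filter (λ e → src e ≟ t) es) ≡⟨ count-filter (λ e → src e ≟ t) _ es ⟩
        count (edgeFromTo t j) es                               ≡⟨ pending-edges t j ≤-refl t<L jL ⟩
        mult t j                                                ∎
        where open ≡-Reasoning

      pending-edges′ : ∀ i j → suc t ≤ i → i < L → j < L → count (edgeFromTo i j) (rest ++ new) ≡ mult i j
      pending-edges′ i j ti iL jL = begin
          count φ (rest ++ new)     ≡⟨ ∑-++ rest new (𝟙 ∘ φ) ⟩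
          count φ rest + count φ new ≡⟨ cong (count φ rest +_) (trans (count-new φ) (∑-zero numbered-ins none-new)) ⟩
          count φ rest + 0           ≡⟨ +-identityʳ _ ⟩
          count φ rest               ≡⟨ count-rest φ ⟩
          count (λ e → not ((src e ≡ᵇ t) ∨ (dst e ≡ᵇ t)) ∧ φ e) es ≡⟨ kept-edges ⟩
          mult i j ∎
        where
        open ≡-Reasoning
        φ : Edge → Bool
        φ = edgeFromTo i j
        none-new : ∀ p → p ∈ numbered-ins →
          𝟙 (φ (proj₁ (proj₂ p) , f + proj₁ p , proj₂ (proj₂ p))) + count (λ o → φ (f + proj₁ p , proj₁ o , proj₂ o)) outs ≡ 0
        none-new p _ rewrite ≡ᵇ-false (f + proj₁ p) j (fresh≢ (proj₁ p) j jL)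
                           | ∧-zeroʳ (proj₁ (proj₂ p) ≡ᵇ i)
                           | ≡ᵇ-false (f + proj₁ p) i (fresh≢ (proj₁ p) i iL)
                           = count-none _ outs (λ _ _ → refl)
        kept-edges : count (λ e → not ((src e ≡ᵇ t) ∨ (dst e ≡ᵇ t)) ∧ φ e) es ≡ mult i j
        kept-edges with j ≟ t
        ... | yes refl = trans (count-none _ es into-t) (sym (acyclic i t (<⇒≤ ti) iL))
          where
          into-t : ∀ e → e ∈ es → (not ((src e ≡ᵇ t) ∨ (dst e ≡ᵇ t)) ∧ φ e) ≡ false
          into-t e _ with dst e ≡ᵇ t
          ... | true rewrite ∨-zeroʳ (src e ≡ᵇ t) = refl
          ... | false rewrite ∧-zeroʳ (src e ≡ᵇ i) = ∧-zeroʳ _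
        ... | no j≢t = trans (∑-cong es (λ e _ → cong 𝟙 (untouched e))) (pending-edges i j (<⇒≤ ti) iL jL)
          where
          untouched : ∀ e → (not ((src e ≡ᵇ t) ∨ (dst e ≡ᵇ t)) ∧ φ e) ≡ φ e
          untouched e with src e ≡ᵇ i in si | dst e ≡ᵇ j in dj
          ... | false | _ = ∧-zeroʳ _
          ... | true | false = ∧-zeroʳ _
          ... | true | true rewrite ≡ᵇ-false (src e) t (λ q → <⇒≢ ti (sym (trans (sym (≡ᵇ-true _ _ si)) q)))
                                  | ≡ᵇ-false (dst e) t (λ q → j≢t (trans (sym (≡ᵇ-true _ _ dj)) q)) = refl

      inflow-bound′ : ∀ j → suc t ≤ j → j < L → count (λ e → (dst e ≡ᵇ j) ∧ fromDone (suc t) e) (rest ++ new) ≤ inflow (suc t) j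
      inflow-bound′ j tj jL = begin
          count ψ (rest ++ new)        ≡⟨ ∑-++ rest new (𝟙 ∘ ψ) ⟩
          count ψ rest + count ψ new   ≤⟨ +-mono-≤ from-rest from-new ⟩
          inflow t j + copies t * mult t j ≡⟨ cong (inflow t j +_) (*-comm (copies t) (mult t j)) ⟩
          inflow (suc t) j ∎
        where
        open ≤-Reasoning
        ψ : Edge → Bool
        ψ e = (dst e ≡ᵇ j) ∧ fromDone (suc t) e
        from-rest : count ψ rest ≤ inflow t j
        from-rest = ≤-trans (≤-reflexive (count-rest ψ)) (≤-trans (count-mono _ _ es done) (inflow-bound j (<⇒≤ tj) jL))
          where
          done : ∀ e → e ∈ es → (not ((src e ≡ᵇ t) ∨ (dst e ≡ᵇ t)) ∧ ψ e) ≡ true → ((dst e ≡ᵇ j) ∧ fromDone t e) ≡ true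
          done e _ h with src e ≟ t
          ... | yes refl rewrite ≡ᵇ-refl (src e) with () ← h
          ... | no ne = cong₂ _∧_ (∧-conicalˡ _ _ ψe) (fromDone-suc t e (∧-conicalʳ (dst e ≡ᵇ j) _ ψe) ne)
            where
            ψe : ψ e ≡ true
            ψe = ∧-conicalʳ (not ((src e ≡ᵇ t) ∨ (dst e ≡ᵇ t))) (ψ e) h
        from-new : count ψ new ≤ copies t * mult t j
        from-new = begin
          count ψ new ≡⟨ count-new ψ ⟩
          ∑[ p ∈ numbered-ins ] (𝟙 (ψ (proj₁ (proj₂ p) , f + proj₁ p , proj₂ (proj₂ p))) +
                                count (λ o → ψ (f + proj₁ p , proj₁ o , proj₂ o)) outs)
            ≡⟨ ∑-cong numbered-ins (λ p _ → copy-edges p) ⟩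
          ∑[ _ ∈ numbered-ins ] mult t j ≡⟨ ∑-const numbered-ins (mult t j) ⟩
          length numbered-ins * mult t j ≤⟨ *-monoˡ-≤ (mult t j) (≤-trans length-numbered-ins length-ins≤copies) ⟩
          copies t * mult t j ∎
          where
          length-numbered-ins : length numbered-ins ≤ length ins
          length-numbered-ins = ≤-trans (≤-reflexive (List.length-zipWith _,_ (upTo (length ins)) ins)) (m⊓n≤n _ _)
          copy-edges : ∀ p → 𝟙 (ψ (proj₁ (proj₂ p) , f + proj₁ p , proj₂ (proj₂ p))) +
                             count (λ o → ψ (f + proj₁ p , proj₁ o , proj₂ o)) outs ≡ mult t j
          copy-edges p rewrite ≡ᵇ-false (f + proj₁ p) j (fresh≢ (proj₁ p) j jL) =
            trans (∑-cong outs (λ o _ → cong 𝟙 (trans (cong ((proj₁ o ≡ᵇ j) ∧_)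
                     (fromDone-≥L (suc t) (f + proj₁ p , proj₁ o , proj₂ o) (≤-trans fresh-≥ (m≤m+n f (proj₁ p)))))
                     (∧-identityʳ _))))
                  (count-outs j jL)

      node-count′ : length (filter (λ x → not (x ≡ᵇ t) Bool.≟ true) ns ++ map (f +_) (upTo (length ins))) ≤ L + newNodes (suc t)
      node-count′ = begin
          length (filter _ ns ++ map (f +_) (upTo (length ins)))
            ≡⟨ List.length-++ (filter (λ x → not (x ≡ᵇ t) Bool.≟ true) ns) ⟩
          length (filter _ ns) + length (map (f +_) (upTo (length ins)))
            ≡⟨ cong (length (filter (λ x → not (x ≡ᵇ t) Bool.≟ true) ns) +_)
                    (trans (List.length-map (f +_) (upTo (length ins))) (List.length-upTo (length ins))) ⟩
          length (filter _ ns) + length ins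
            ≤⟨ +-mono-≤ (≤-trans (List.length-filter _ ns) node-count) length-ins≤copies ⟩
          L + newNodes t + copies t
            ≡⟨ +-assoc L (newNodes t) (copies t) ⟩
          L + (newNodes t + copies t)
            ≡⟨ cong (L +_) (sym new-copies) ⟩
          L + newNodes (suc t) ∎
        where
        open ≤-Reasoning
        new-copies : newNodes (suc t) ≡ newNodes t + copies t
        new-copies rewrite newNodes-suc t | not-kept = refl

      invariant-expand : Invariant (suc t) (expandNode g t (graph ns es f))
      invariant-expand = record
        { fresh-≥ = ≤-trans fresh-≥ (m≤m+n f (length ins))
        ; pending-edges = pending-edges′
        ; inflow-bound = inflow-bound′
        ; node-count = node-count′
        }

    invariant-step : ∀ t G → t < L → Invariant t G → Invariant (suc t) (if keptAt t then G else expandNode g t G)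
    invariant-step t G t<L I with keptAt t in k
    ... | true = invariant-kept t G k t<L I
    invariant-step t (graph ns es f) t<L I | false = Expand.invariant-expand t ns es f t<L k I

    invariant-initial : Invariant 0 (graphG g ord)
    invariant-initial = record
      { fresh-≥ = ≤-refl
      ; pending-edges = λ i j _ iL jL → trans (cong (count _) edges≡) (initial-edges i j iL jL)
      ; inflow-bound = λ j _ _ → ≤-reflexive (trans (cong (count _) edges≡) (nothing-done j))
      ; node-count = ≤-trans (≤-reflexive (List.length-upTo L)) (m≤m+n L 0)
      }
      where
      I = enumerate 0 ord
      edges≡ : Graph.edges (graphG g ord) ≡ edgesOf I
      edges≡ = cong edgesOf indexed≡enumerate
      letters : DState g → DState g → (Edge → Bool) → ℕ → ℕ → ℕ
      letters S T φ i j = ∑[ c ∈ allFin σ ] 𝟙 (eqD g (δ g S c) T ∧ φ (i , j , c))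
      initial-edges : ∀ i j → i < L → j < L → count (edgeFromTo i j) (edgesOf I) ≡ mult i j
      initial-edges i j iL jL = trans (count-edgesOf φ I) (trans (∑-cong I row) (∑-enumerate-select 0 ord i _ iL))
        where
        φ = edgeFromTo i j
        entry : ∀ p q → letters (proj₂ p) (proj₂ q) φ (proj₁ p) (proj₁ q) ≡
          (if proj₁ p ≡ᵇ i then (if proj₁ q ≡ᵇ j then count (λ c → eqD g (δ g (proj₂ p) c) (proj₂ q)) (allFin σ) else 0) else 0)
        entry p q with proj₁ p ≡ᵇ i | proj₁ q ≡ᵇ j
        ... | false | _ = ∑-zero (allFin σ) (λ c _ → cong 𝟙 (∧-zeroʳ _))
        ... | true | false = ∑-zero (allFin σ) (λ c _ → cong 𝟙 (∧-zeroʳ _))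
        ... | true | true = ∑-cong (allFin σ) (λ c _ → cong 𝟙 (∧-identityʳ _))
        row : ∀ p → p ∈ I → ∑[ q ∈ I ] letters (proj₂ p) (proj₂ q) φ (proj₁ p) (proj₁ q) ≡
          (if proj₁ p ≡ᵇ i then count (λ c → eqD g (δ g (proj₂ p) c) (stateAt j)) (allFin σ) else 0)
        row p _ = trans (∑-cong I (λ q _ → entry p q)) (trans (∑-if (proj₁ p ≡ᵇ i) I _)
          (cong (λ n → if proj₁ p ≡ᵇ i then n else 0) (∑-enumerate-select 0 ord j _ jL)))
      nothing-done : ∀ j → count (λ e → (dst e ≡ᵇ j) ∧ fromDone 0 e) (edgesOf I) ≡ 0
      nothing-done j = trans (count-edgesOf _ I) (∑-zero I (λ p p∈ → ∑-zero I (λ q _ → ∑-zero (allFin σ) (λ c _ →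
        trans (cong (λ b → 𝟙 (eqD g (δ g (proj₂ p) c) (proj₂ q) ∧ ((proj₁ q ≡ᵇ j) ∧ b)))
                    (fromDone-pending 0 (proj₁ p , proj₁ q , c) z≤n (enumerate-index< 0 ord p∈)))
              (cong 𝟙 (trans (cong (eqD g (δ g (proj₂ p) c) (proj₂ q) ∧_) (∧-zeroʳ _)) (∧-zeroʳ _)))))))

    invariant-run : ∀ t Ss G → (∀ k → nth Ss k ≡ stateAt (t + k)) → t + length Ss ≡ L → Invariant t G →
      Invariant L (processAll g (enumerate t Ss) G)
    invariant-run t [] G _ t≡L I = subst (λ u → Invariant u G) (trans (sym (+-identityʳ t)) t≡L) I
    invariant-run t (S ∷ Ss) G S≡ t+≡L I = invariant-run (suc t) Ss _
      (λ k → trans (S≡ (suc k)) (cong stateAt (+-suc t k)))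
      (trans (sym (+-suc t (length Ss))) t+≡L)
      (subst (λ T → Invariant (suc t) (if kept g T then G else expandNode g t G)) (sym (trans (S≡ 0) (cong stateAt (+-identityʳ t))))
             (invariant-step t G t<L I))
      where
      t<L : t < L
      t<L = ≤-trans (m<m+n t (s≤s z≤n)) (≤-reflexive t+≡L)

    nodeCountG′≤L+newNodes : nodeCountG′ g ord ≤ L + newNodes L
    nodeCountG′≤L+newNodes = subst (λ I → length (Graph.nodes (processAll g I (graphG g ord))) ≤ L + newNodes L) (sym indexed≡enumerate)
      (Invariant.node-count (invariant-run 0 ord (graphG g ord) (λ k → refl) refl invariant-initial))

module Sizes {σ : ℕ} (g : EBG σ) (wf : WellFormed g) where

  open Counting
  open import Data.Nat using (ℕ; zero; suc; _+_; _*_; _≤_; z≤n; s≤s)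
  open import Data.Nat.Properties
  open import Data.Bool using (Bool; true)
  open import Data.List using (List; map; concatMap; allFin)
  import Data.List.Properties as List
  open import Data.Fin using (Fin)
  import Data.Fin as Fin
  import Data.Fin.Properties as Fin
  open import Data.Maybe using (just)
  open import Data.Product using (_,_)
  open import Relation.Nullary using (does)
  open import Relation.Nullary.Decidable using (dec-true)
  open import Relation.Binary.PropositionalEquality
  open import Data.List.Membership.Propositional using (_∈_)
  open import Data.List.Membership.Propositional.Properties using (∈-allFin; ∈-map⁺)

  open EBG g

  blockSize≤W : ∀ B → blockSize g B ≤ W g
  blockSize≤W B = ≤-foldr⊔ (map (blockSize g) (allFin b)) (∈-map⁺ (blockSize g) (∈-allFin B))

  sameBlock≤W : ∀ (P : Fin n → Bool) v → (∀ u → P u ≡ true → blk u ≡ blk v) → count P (allFin n) ≤ W g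
  sameBlock≤W P v same = begin
    count P (allFin n)                                    ≤⟨ count-mono _ _ (allFin n) (λ u _ Pu → dec-true (blk u Fin.≟ blk v) (same u Pu)) ⟩
    count (λ u → does (blk u Fin.≟ blk v)) (allFin n)    ≡⟨ length-filter≡count (λ u → blk u Fin.≟ blk v) (allFin n) ⟨
    blockSize g (blk v)                                   ≤⟨ blockSize≤W (blk v) ⟩
    W g                                                   ∎
    where open ≤-Reasoning

  W-pos : Fin n → 1 ≤ W g
  W-pos v = ≤-trans (count-pos (λ u → does (u Fin.≟ v)) (allFin n) (∈-allFin v) (dec-true (v Fin.≟ v) refl))
                    (sameBlock≤W _ v (λ u e → cong blk (does-true (u Fin.≟ v) e)))

  -- All in-neighbours of w lie in the block preceding that of w.
  indegree≤W : ∀ w → count (λ u → edge u w) (allFin n) ≤ W g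
  indegree≤W w with count (λ u → edge u w) (allFin n) in indegree
  ... | zero = z≤n
  ... | suc _ with count-pos⁻ (λ u → edge u w) (allFin n) (subst (1 ≤_) (sym indegree) (s≤s z≤n))
  ...   | u₀ , _ , u₀w = subst (_≤ W g) indegree (sameBlock≤W _ u₀ same-block)
    where
    same-block : ∀ u → edge u w ≡ true → blk u ≡ blk u₀
    same-block u uw = Fin.toℕ-injective (suc-injective (trans (sym (WellFormed.edges-consecutive wf u w uw))
                                                              (WellFormed.edges-consecutive wf u₀ w u₀w)))

  nodeStates : Fin n → List (NState g)
  nodeStates v = map (λ k → just (v , k)) (allFin (len g v))

  N≡ : N g ≡ suc (∑[ v ∈ allFin n ] len g v)
  N≡ = cong suc (trans (length≡∑ (concatMap nodeStates (allFin n)))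
         (trans (∑-concatMap nodeStates (allFin n) (λ _ → 1))
                (∑-cong (allFin n) (λ v _ → trans (sym (length≡∑ (nodeStates v)))
                                            (trans (List.length-map _ (allFin (len g v))) (List.length-tabulate (λ k → k)))))))

  n<N : suc n ≤ N g
  n<N = begin
    suc n                          ≡⟨ cong suc (trans (sym (List.length-tabulate {n = n} (λ v → v))) (length≡∑ (allFin n))) ⟩
    suc (∑[ v ∈ allFin n ] 1)      ≤⟨ s≤s (∑-mono (allFin n) (λ v _ → s≤s z≤n)) ⟩
    suc (∑[ v ∈ allFin n ] len g v) ≡⟨ N≡ ⟨
    N g                            ∎
    where open ≤-Reasoning

  N≤NW+1 : N g ≤ N g * W g + 1
  N≤NW+1 with W g in W≡
  ... | suc w = ≤-trans (m≤m*n (N g) (suc w)) (m≤m+n _ 1)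
  ... | zero = ≤-reflexive (trans N≡ (trans (cong suc (∑-zero (allFin n) no-nodes)) (sym (cong (_+ 1) (*-zeroʳ (N g))))))
    where
    no-nodes : ∀ v → v ∈ allFin n → len g v ≡ 0
    no-nodes v _ with () ← subst (1 ≤_) W≡ (W-pos v)

module Analysis {σ : ℕ} (g : EBG σ) (wf : WellFormed g) (rf : RepeatFree g) (ord : List (DState g)) (unique : Unique ord)
  (ord-spec : ∀ (S : DState g) → (S ∈ ord) ⇔ (Reachable g S × NonemptyD g S))
  (topo : TopOrdered g ord) where

  open Counting
  open import Data.Nat using (ℕ; zero; suc; _+_; _*_; _≤_; _<_; z≤n; s≤s; _≡ᵇ_)
  open import Data.Nat.Properties
  open import Data.Nat.Induction using (<-rec)
  open import Data.Bool using (Bool; true; false; _∧_; not; if_then_else_)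
  open import Data.Bool.Properties using (∨-conicalˡ; ∨-conicalʳ; ∧-conicalˡ; ∧-conicalʳ)
  open import Data.List using (List; []; _∷_; _++_; _∷ʳ_; map; length; allFin; upTo; foldl; lookup; cartesianProduct; initLast; _∷ʳ′_)
  import Data.List.Properties as List
  open import Data.Fin using (Fin; toℕ; fromℕ<)
  import Data.Fin as Fin
  import Data.Fin.Properties as Fin
  open import Data.Maybe using (Maybe; just; nothing)
  import Data.Maybe.Properties as Maybe
  import Data.Product.Properties as Product
  open import Data.Product using (Σ; _×_; _,_; ∃-syntax; proj₁; proj₂)
  open import Data.Sum using (_⊎_; inj₁; inj₂)
  open import Relation.Nullary using (contradiction)
  open import Relation.Binary.PropositionalEquality
  open import Data.List.Membership.Propositional using (_∈_)
  open import Data.List.Membership.Propositional.Properties using (∈-allFin; ∈-map⁺; ∈-upTo⁺; ∈-upTo⁻; ∈-cartesianProduct⁺; ∈-cartesianProduct⁻)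
  open import Data.List.Relation.Unary.Any using (here; there)
  open import Data.List.Relation.Unary.Unique.Propositional using (Unique)
  import Data.List.Relation.Unary.Unique.Propositional.Properties as Unique
  open import Data.List.Relation.Unary.AllPairs using (_∷_)
  import Data.List.Relation.Unary.All as All
  open import Function.Bundles using (_⇔_; Equivalence)
  open import Relation.Binary using (DecidableEquality)
  open import Function using (_∘_)
  open import Data.Nat.Solver using (module +-*-Solver)
  open +-*-Solver using (solve; _:+_; _:*_; _:=_; con)

  open EBG g
  open Expansion g ord
  open SubsetConstruction g
  open RepeatFreeness rf
  open Sizes g wf

  nth-∈ : ∀ Ss i → i < length Ss → nth Ss i ∈ Ss
  nth-∈ (S ∷ Ss) zero _ = here refl
  nth-∈ (S ∷ Ss) (suc i) (s≤s i<) = there (nth-∈ Ss i i<)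

  ∈⇒nth : ∀ Ss {S} → S ∈ Ss → ∃[ i ] i < length Ss × nth Ss i ≡ S
  ∈⇒nth (S ∷ Ss) (here refl) = 0 , s≤s z≤n , refl
  ∈⇒nth (S ∷ Ss) (there S∈) with ∈⇒nth Ss S∈
  ... | i , i< , e = suc i , s≤s i< , e

  nth-injective : ∀ Ss → Unique Ss → ∀ i j → i < length Ss → j < length Ss → nth Ss i ≡ nth Ss j → i ≡ j
  nth-injective (S ∷ Ss) (_ ∷ _) zero zero _ _ _ = refl
  nth-injective (S ∷ Ss) (S∉ ∷ _) zero (suc j) _ (s≤s j<) e = contradiction e (All.lookup S∉ (nth-∈ Ss j j<))
  nth-injective (S ∷ Ss) (S∉ ∷ _) (suc i) zero (s≤s i<) _ e = contradiction (sym e) (All.lookup S∉ (nth-∈ Ss i i<))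
  nth-injective (S ∷ Ss) (_ ∷ u) (suc i) (suc j) (s≤s i<) (s≤s j<) e = cong suc (nth-injective Ss u i j i< j< e)

  lookup≡nth : ∀ Ss (i : Fin (length Ss)) → lookup Ss i ≡ nth Ss (toℕ i)
  lookup≡nth (S ∷ Ss) Fin.zero = refl
  lookup≡nth (S ∷ Ss) (Fin.suc i) = lookup≡nth Ss i

  stateAt-injective : ∀ i j → i < L → j < L → stateAt i ≡ stateAt j → i ≡ j
  stateAt-injective = nth-injective ord unique

  stateAt-reachable : ∀ i → i < L → Reachable g (stateAt i)
  stateAt-reachable i i<L = proj₁ (Equivalence.to (ord-spec (stateAt i)) (nth-∈ ord i i<L))

  tabulated-stateAt : ∀ i → i < L → Tabulated (stateAt i)
  tabulated-stateAt i i<L with stateAt-reachable i i<L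
  ... | x , reached = subst Tabulated reached (tabulated-reachable x)

  stateAt-nonempty : ∀ i → i < L → ∃[ t ] t ∈ˢ stateAt i
  stateAt-nonempty i i<L = nonempty⇒∈ (stateAt i) (tabulated-stateAt i i<L)
                                      (proj₂ (Equivalence.to (ord-spec (stateAt i)) (nth-∈ ord i i<L)))

  reads-stateAt : ∀ i → (i<L : i < L) → Reads (proj₁ (stateAt-reachable i i<L)) (stateAt i)
  reads-stateAt i i<L with stateAt-reachable i i<L
  ... | x , reached = subst (Reads x) reached (reads-reachable x)

  shape-stateAt : ∀ i → i < L → Shape (stateAt i)
  shape-stateAt i i<L with stateAt-reachable i i<L
  ... | x , reached = subst Shape reached (shape-reachable x)

  edge-forward : ∀ i j c → i < L → j < L → δ g (stateAt i) c ≡ stateAt j → i < j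
  edge-forward i j c i<L j<L e = subst₂ _<_ (Fin.toℕ-fromℕ< i<L) (Fin.toℕ-fromℕ< j<L)
    (topo (fromℕ< i<L) (fromℕ< j<L) (c , trans (cong (λ S → δ g S c) (lookup≡stateAt i i<L)) (trans e (sym (lookup≡stateAt j j<L)))))
    where
    lookup≡stateAt : ∀ i → (i<L : i < L) → lookup ord (fromℕ< i<L) ≡ stateAt i
    lookup≡stateAt i i<L = trans (lookup≡nth ord (fromℕ< i<L)) (cong stateAt (Fin.toℕ-fromℕ< i<L))

  acyclic : ∀ i j → j ≤ i → i < L → mult i j ≡ 0
  acyclic i j j≤i i<L = count-none _ (allFin σ) no-letter
    where
    no-letter : ∀ c → c ∈ allFin σ → eqD g (δ g (stateAt i) c) (stateAt j) ≡ false
    no-letter c _ with eqD g (δ g (stateAt i) c) (stateAt j) in e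
    ... | false = refl
    ... | true = contradiction (edge-forward i j c i<L (≤-<-trans j≤i i<L) (eqD-true _ _ e)) (≤⇒≯ j≤i)

  kept-boundary : ∀ i → i < L → keptAt i ≡ true → ∀ s → s ∈ˢ stateAt i → AtBoundary s
  kept-boundary i i<L kept s s∈ with atEndD g (stateAt i) in end
  ... | true with atEndD-true⁻ (stateAt i) end
  ...   | just (u , ku) , u∈ , u-end = inj₂ (subst (λ t → atEnd g t ≡ true)
                                          (sym (end-state-alone _ (stateAt i) (reads-stateAt i i<L) u ku u∈ u-end s s∈)) u-end)
  kept-boundary i i<L kept s s∈ | false = inj₁ (∈initial⁻ s (subst (s ∈ˢ_) (eqD-true _ _ kept) s∈))

  KeptShape : DState g → Set
  KeptShape S = (S ≡ initialD g) ⊎ (Σ (Fin n) λ u → EndOf u S)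

  kept-shape : ∀ i → i < L → keptAt i ≡ true → KeptShape (stateAt i)
  kept-shape i i<L kept with atEndD g (stateAt i) in end
  ... | true with atEndD-true⁻ (stateAt i) end
  ...   | just (u , ku) , u∈ , u-end = inj₂ (u , ku , u∈ , u-end , end-state-alone _ (stateAt i) (reads-stateAt i i<L) u ku u∈ u-end)
  kept-shape i i<L kept | false = inj₁ (eqD-true _ _ kept)

  unkept-not-end : ∀ i → keptAt i ≡ false → atEndD g (stateAt i) ≡ false
  unkept-not-end i not-kept = ∨-conicalˡ _ _ not-kept

  unkept-not-initial : ∀ i → keptAt i ≡ false → stateAt i ≢ initialD g
  unkept-not-initial i not-kept e with () ← trans (sym (subst (λ S → eqD g S (initialD g) ≡ true) (sym e) (eqD-refl (initialD g))))
                                                   (∨-conicalʳ _ _ not-kept)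

  unkept-uniform : ∀ i → i < L → keptAt i ≡ false → Uniform (prefixOf (stateAt i)) (stateAt i)
  unkept-uniform i i<L not-kept with shape-stateAt i i<L | stateAt-nonempty i i<L
  ... | inj₂ (inj₂ (p , uniform)) | t , t∈ = subst (λ q → Uniform q (stateAt i)) (sym (prefixOf-uniform p (stateAt i) t uniform t∈)) uniform
  ... | inj₂ (inj₁ (u , ku , u∈ , u-end , _)) | _ with () ← trans (sym (atEndD-true⁺ (stateAt i) _ u∈ u-end)) (unkept-not-end i not-kept)
  ... | inj₁ initial-only | t , t∈ with stateAt-reachable i i<L | reads-stateAt i i<L
  ...   | x , reached | reads-nothing , _ = contradiction
    (trans (sym reached) (cong (δ* g (initialD g)) (reads-nothing (subst (_∈ˢ stateAt i) (initial-only t t∈) t∈))))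
    (unkept-not-initial i not-kept)

  -- Kept states lie on block boundaries, where the prefix restarts.
  prefixAt : ℕ → List (Fin σ)
  prefixAt i = if keptAt i then [] else prefixOf (stateAt i)

  prefix-step : ∀ i′ i c → i′ < L → i < L → keptAt i ≡ false → δ g (stateAt i′) c ≡ stateAt i →
    prefixOf (stateAt i) ≡ prefixAt i′ ∷ʳ c
  prefix-step i′ i c i′<L i<L not-kept e with stateAt-nonempty i i<L | keptAt i′ in kept′
  ... | t , t∈ | true = prefixOf-uniform (c ∷ []) (stateAt i) t
          (subst (Uniform (c ∷ [])) e (uniform-after-boundary (stateAt i′) c (kept-boundary i′ i′<L kept′) not-end)) t∈
    where
    not-end : atEndD g (δ g (stateAt i′) c) ≡ false
    not-end = subst (λ S → atEndD g S ≡ false) (sym e) (unkept-not-end i not-kept)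
  ... | t , t∈ | false = prefixOf-uniform _ (stateAt i) t
          (subst (Uniform (prefixOf (stateAt i′) ∷ʳ c)) e (uniform-δ (stateAt i′) c _ (unkept-uniform i′ i′<L kept′) not-end)) t∈
    where
    not-end : atEndD g (δ g (stateAt i′) c) ≡ false
    not-end = subst (λ S → atEndD g S ≡ false) (sym e) (unkept-not-end i not-kept)

  indices : List ℕ
  indices = upTo L

  leadsTo : ℕ → ℕ → Bool
  leadsTo k i = eqD g (δ* g (stateAt k) (prefixOf (stateAt i))) (stateAt i)

  keptSources : ℕ → ℕ
  keptSources i = count (λ k → keptAt k ∧ leadsTo k i) indices

  -- Bounds copies i′ by induction on i′.
  source : ℕ → ℕ → Bool
  source i′ k = if keptAt i′ then k ≡ᵇ i′ else keptAt k ∧ leadsTo k i′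

  route : ℕ → ℕ → Fin σ → ℕ → Bool
  route i i′ c k = eqD g (δ g (stateAt i′) c) (stateAt i) ∧ source i′ k

  record Route (i i′ : ℕ) (c : Fin σ) (k : ℕ) : Set where
    field
      source-kept : keptAt k ≡ true
      reaches-predecessor : δ* g (stateAt k) (prefixAt i′) ≡ stateAt i′
      prefix-extends : prefixOf (stateAt i) ≡ prefixAt i′ ∷ʳ c
      predecessor-step : δ g (stateAt i′) c ≡ stateAt i

  route⇒Route : ∀ i i′ c k → i < L → i′ < L → keptAt i ≡ false → route i i′ c k ≡ true → Route i i′ c k
  route⇒Route i i′ c k i<L i′<L not-kept r with keptAt i′ in kept′
  ... | true with ≡ᵇ-true k i′ (∧-conicalʳ _ _ r)
  ...   | refl = record
      { source-kept = kept′
      ; reaches-predecessor = cong (δ* g (stateAt k)) (cong (if_then [] else prefixOf (stateAt k)) kept′)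
      ; prefix-extends = prefix-step k i c i′<L i<L not-kept step
      ; predecessor-step = step
      }
    where
    step = eqD-true _ _ (∧-conicalˡ _ _ r)
  route⇒Route i i′ c k i<L i′<L not-kept r | false = record
      { source-kept = ∧-conicalˡ _ _ leads
      ; reaches-predecessor = trans (cong (δ* g (stateAt k)) (cong (if_then [] else prefixOf (stateAt i′)) kept′))
                                    (eqD-true _ _ (∧-conicalʳ _ _ leads))
      ; prefix-extends = prefix-step i′ i c i′<L i<L not-kept step
      ; predecessor-step = step
      }
    where
    step = eqD-true _ _ (∧-conicalˡ _ _ r)
    leads = ∧-conicalʳ (eqD g (δ g (stateAt i′) c) (stateAt i)) _ r

  route-keptSource : ∀ i i′ c k → i < L → i′ < L → keptAt i ≡ false → route i i′ c k ≡ true → (keptAt k ∧ leadsTo k i) ≡ true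
  route-keptSource i i′ c k i<L i′<L not-kept r =
    cong₂ _∧_ source-kept (subst (λ S → eqD g S (stateAt i) ≡ true) (sym reaches) (eqD-refl (stateAt i)))
    where
    open Route (route⇒Route i i′ c k i<L i′<L not-kept r)
    open ≡-Reasoning
    reaches : δ* g (stateAt k) (prefixOf (stateAt i)) ≡ stateAt i
    reaches = begin
      δ* g (stateAt k) (prefixOf (stateAt i))           ≡⟨ cong (δ* g (stateAt k)) prefix-extends ⟩
      foldl (δ g) (stateAt k) (prefixAt i′ ++ c ∷ [])   ≡⟨ List.foldl-++ (δ g) (stateAt k) (prefixAt i′) (c ∷ []) ⟩
      δ g (δ* g (stateAt k) (prefixAt i′)) c            ≡⟨ cong (λ S → δ g S c) reaches-predecessor ⟩
      δ g (stateAt i′) c                                ≡⟨ predecessor-step ⟩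
      stateAt i                                         ∎

  -- The prefix of stateAt i determines both the letter and (through the kept source) the predecessor.
  route-unique : ∀ i i′ i″ c c′ k → i < L → i′ < L → i″ < L → keptAt i ≡ false →
    route i i′ c k ≡ true → route i i″ c′ k ≡ true → i′ ≡ i″ × c ≡ c′
  route-unique i i′ i″ c c′ k i<L i′<L i″<L not-kept r r′ =
    stateAt-injective i′ i″ i′<L i″<L
      (trans (sym (Route.reaches-predecessor R)) (trans (cong (δ* g (stateAt k)) (List.∷ʳ-injectiveˡ _ _ prefixes))
             (Route.reaches-predecessor R′))) ,
    List.∷ʳ-injectiveʳ _ _ prefixes
    where
    R = route⇒Route i i′ c k i<L i′<L not-kept r
    R′ = route⇒Route i i″ c′ k i<L i″<L not-kept r′
    prefixes : prefixAt i′ ∷ʳ c ≡ prefixAt i″ ∷ʳ c′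
    prefixes = trans (sym (Route.prefix-extends R)) (Route.prefix-extends R′)

  routes-via : ∀ i → i < L → keptAt i ≡ false → ∀ k →
    ∑[ i′ ∈ upTo i ] count (λ c → route i i′ c k) (allFin σ) ≤ 𝟙 (keptAt k ∧ leadsTo k i)
  routes-via i i<L not-kept k with keptAt k ∧ leadsTo k i in is-source
  ... | true = ∑-atMostOne (upTo i) _ (Unique.upTo⁺ i) one-letter same-predecessor
    where
    below : ∀ {i′} → i′ ∈ upTo i → i′ < L
    below i′∈ = <-trans (∈-upTo⁻ i′∈) i<L
    one-letter : ∀ i′ → i′ ∈ upTo i → count (λ c → route i i′ c k) (allFin σ) ≤ 1
    one-letter i′ i′∈ = ∑-atMostOne (allFin σ) _ (Unique.allFin⁺ σ) (λ c _ → 𝟙≤1 _)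
      (λ _ _ p p′ → proj₂ (route-unique i i′ i′ _ _ k i<L (below i′∈) (below i′∈) not-kept (𝟙-pos _ p) (𝟙-pos _ p′)))
    same-predecessor : ∀ {i′ i″} → i′ ∈ upTo i → i″ ∈ upTo i →
      1 ≤ count (λ c → route i i′ c k) (allFin σ) → 1 ≤ count (λ c → route i i″ c k) (allFin σ) → i′ ≡ i″
    same-predecessor {i′} {i″} i′∈ i″∈ p p′ with count-pos⁻ _ (allFin σ) p | count-pos⁻ _ (allFin σ) p′
    ... | c , _ , r | c′ , _ , r′ = proj₁ (route-unique i i′ i″ c c′ k i<L (below i′∈) (below i″∈) not-kept r r′)
  ... | false = ≤-reflexive (∑-zero (upTo i) (λ i′ i′∈ → count-none _ (allFin σ) (no-route i′ i′∈)))
    where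
    no-route : ∀ i′ → i′ ∈ upTo i → ∀ c → c ∈ allFin σ → route i i′ c k ≡ false
    no-route i′ i′∈ c _ with route i i′ c k in r
    ... | false = refl
    ... | true with () ← trans (sym (route-keptSource i i′ c k i<L (<-trans (∈-upTo⁻ i′∈) i<L) not-kept r)) is-source

  copies-unkept : ∀ t → keptAt t ≡ false → copies t ≡ inflow t t
  copies-unkept t not-kept rewrite not-kept = refl

  -- Double counting: every copy of i is reached along a route from a kept source,
  -- and each kept source leads to i along at most one route.
  copies≤keptSources : ∀ i → i < L → keptAt i ≡ false → copies i ≤ keptSources i
  copies≤keptSources = <-rec _ λ i rec i<L not-kept → begin
      copies i
        ≡⟨ trans (copies-unkept i not-kept) (inflow≡∑ i i) ⟩
      ∑[ i′ ∈ upTo i ] (mult i′ i * copies i′)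
        ≤⟨ ∑-mono (upTo i) (λ i′ i′∈ → *-monoʳ-≤ (mult i′ i) (copies≤sources rec i<L i′ (∈-upTo⁻ i′∈))) ⟩
      ∑[ i′ ∈ upTo i ] (mult i′ i * count (source i′) indices)
        ≡⟨ ∑-cong (upTo i) (λ i′ _ → mult*sources i i′) ⟩
      ∑[ i′ ∈ upTo i ] ∑[ c ∈ allFin σ ] count (route i i′ c) indices
        ≡⟨ ∑-cong (upTo i) (λ i′ _ → ∑-swap (allFin σ) indices _) ⟩
      ∑[ i′ ∈ upTo i ] ∑[ k ∈ indices ] count (λ c → route i i′ c k) (allFin σ)
        ≡⟨ ∑-swap (upTo i) indices _ ⟩
      ∑[ k ∈ indices ] ∑[ i′ ∈ upTo i ] count (λ c → route i i′ c k) (allFin σ)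
        ≤⟨ ∑-mono indices (λ k _ → routes-via i i<L not-kept k) ⟩
      keptSources i ∎
    where
    open ≤-Reasoning
    copies≤sources : ∀ {i} → (∀ {i′} → i′ < i → i′ < L → keptAt i′ ≡ false → copies i′ ≤ keptSources i′) →
      i < L → ∀ i′ → i′ < i → copies i′ ≤ count (source i′) indices
    copies≤sources {i} rec i<L i′ i′<i with keptAt i′ in kept′
    ... | true = count-pos _ indices (∈-upTo⁺ (<-trans i′<i i<L)) (≡ᵇ-refl i′)
    ... | false = subst (_≤ keptSources i′) (copies-unkept i′ kept′) (rec i′<i (<-trans i′<i i<L) kept′)
    mult*sources : ∀ i i′ → mult i′ i * count (source i′) indices ≡ ∑[ c ∈ allFin σ ] count (route i i′ c) indices
    mult*sources i i′ = trans (∑-*ʳ (allFin σ) _ (count (source i′) indices))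
                              (∑-cong (allFin σ) (λ c _ → 𝟙*count _ (source i′) indices))

  predecessor : ∀ i → i < L → keptAt i ≡ false → ∃[ i′ ] i′ < i × 1 ≤ mult i′ i
  predecessor i i<L not-kept with stateAt-reachable i i<L
  ... | x , reached with initLast x
  ...   | [] = contradiction (sym reached) (unkept-not-initial i not-kept)
  ...   | y ∷ʳ′ c = after-step (δ* g (initialD g) y) (y , refl) (trans (sym (List.foldl-++ (δ g) (initialD g) y (c ∷ []))) reached)
    where
    after-step : ∀ S → Reachable g S → δ g S c ≡ stateAt i → ∃[ i′ ] i′ < i × 1 ≤ mult i′ i
    after-step S reachable step with ∈⇒nth ord (Equivalence.from (ord-spec S) (reachable , nonempty))
      where
      nonempty : NonemptyD g S
      nonempty with stateAt-nonempty i i<L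
      ... | t , t∈ with ∈δ⁻ S c t (subst (t ∈ˢ_) (sym step) t∈)
      ...   | s , s∈ , _ = ∈⇒nonempty S s s∈
    ... | i′ , i′<L , i′≡ = i′ , edge-forward i′ i c i′<L i<L step′ ,
        count-pos _ (allFin σ) (∈-allFin c) (subst (λ S → eqD g S (stateAt i) ≡ true) (sym step′) (eqD-refl (stateAt i)))
      where
      step′ : δ g (stateAt i′) c ≡ stateAt i
      step′ = trans (cong (λ S → δ g S c) i′≡) step

  copies-pos : ∀ i → i < L → 1 ≤ copies i
  copies-pos = <-rec _ copies-pos′
    where
    copies-pos′ : ∀ i → (∀ {i′} → i′ < i → i′ < L → 1 ≤ copies i′) → i < L → 1 ≤ copies i
    copies-pos′ i rec i<L with keptAt i in kept
    ... | true = s≤s z≤n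
    ... | false with predecessor i i<L kept
    ...   | i′ , i′<i , edge = begin
      1                                        ≤⟨ *-mono-≤ edge (rec i′<i (<-trans i′<i i<L)) ⟩
      mult i′ i * copies i′                    ≤⟨ term≤∑ (upTo i) (λ j → mult j i * copies j) (∈-upTo⁺ i′<i) ⟩
      ∑[ j ∈ upTo i ] (mult j i * copies j)    ≡⟨ inflow≡∑ i i ⟨
      inflow i i                               ∎
      where open ≤-Reasoning

  firstNode-initialD : firstNode (initialD g) ≡ nothing
  firstNode-initialD = firstNode-initialOnly (initialD g) nothing ∈initial⁻ nothing∈initial

  -- A kept state is {initial state} or {end of u}, so it is determined by firstNode.
  kept-determined : ∀ k k′ → k < L → k′ < L → keptAt k ≡ true → keptAt k′ ≡ true →
    firstNode (stateAt k) ≡ firstNode (stateAt k′) → stateAt k ≡ stateAt k′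
  kept-determined k k′ k<L k′<L kept kept′ same with kept-shape k k<L kept | kept-shape k′ k′<L kept′
  ... | inj₁ e | inj₁ e′ = trans e (sym e′)
  ... | inj₁ e | inj₂ (u′ , end′)
    with () ← trans (sym (trans (cong firstNode e) firstNode-initialD)) (trans same (firstNode-endOf u′ _ end′))
  ... | inj₂ (u , end) | inj₁ e′
    with () ← trans (sym (trans (cong firstNode e′) firstNode-initialD)) (trans (sym same) (firstNode-endOf u _ end))
  ... | inj₂ (u , end@(ku , u∈ , u-end , alone)) | inj₂ (u′ , end′@(ku′ , u′∈ , u′-end , alone′))
    with Maybe.just-injective (trans (sym (firstNode-endOf u _ end)) (trans same (firstNode-endOf u′ _ end′)))
  ...   | refl with Fin.toℕ-injective {i = ku} {j = ku′} (suc-injective (trans (atEnd⇒last u ku u-end) (sym (atEnd⇒last u ku′ u′-end))))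
  ...     | refl = ∈ˢ-extensional (stateAt k) (stateAt k′) (tabulated-stateAt k k<L) (tabulated-stateAt k′ k′<L)
                     (λ t t∈ → subst (_∈ˢ stateAt k′) (sym (alone t t∈)) u′∈)
                     (λ t t∈ → subst (_∈ˢ stateAt k) (sym (alone′ t t∈)) u∈)

  kept-injective : ∀ {k k′} → k ∈ indices → k′ ∈ indices → keptAt k ≡ true → keptAt k′ ≡ true →
    firstNode (stateAt k) ≡ firstNode (stateAt k′) → k ≡ k′
  kept-injective {k} {k′} k∈ k′∈ kept kept′ same =
    stateAt-injective k k′ (∈-upTo⁻ k∈) (∈-upTo⁻ k′∈) (kept-determined k k′ (∈-upTo⁻ k∈) (∈-upTo⁻ k′∈) kept kept′ same)

  maybeNodes : List (Maybe (Fin n))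
  maybeNodes = nothing ∷ map just (allFin n)

  ∈-maybeNodes : ∀ mu → mu ∈ maybeNodes
  ∈-maybeNodes nothing = here refl
  ∈-maybeNodes (just u) = there (∈-map⁺ just (∈-allFin u))

  firstStates : List (Maybe (NState g))
  firstStates = map just (states g)

  kept≤N : count keptAt indices ≤ N g
  kept≤N = begin
    count keptAt indices             ≤⟨ count-injection (Maybe.≡-dec Fin._≟_) indices maybeNodes keptAt (λ _ → true)
                                          (λ k → firstNode (stateAt k)) (Unique.upTo⁺ L) (λ _ _ _ → ∈-maybeNodes _ , refl) kept-injective ⟩
    count (λ _ → true) maybeNodes    ≤⟨ count≤length (λ _ → true) maybeNodes ⟩
    suc (length (map just (allFin n))) ≡⟨ cong suc (trans (List.length-map just (allFin n)) (List.length-tabulate (λ v → v))) ⟩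
    suc n                            ≤⟨ n<N ⟩
    N g                              ∎
    where open ≤-Reasoning

  -- A kept source k of i records the node whose end it is (nothing for the initial state);
  -- i records its first NFA state.
  Token : Set
  Token = Maybe (Fin n) × Maybe (NState g)

  token : ℕ × ℕ → Token
  token (i , k) = firstNode (stateAt k) , firstState (stateAt i)

  consistent : Token → Bool
  consistent (nothing , just (just (w , _))) = toℕ (blk w) ≡ᵇ 0
  consistent (just u , just (just (w , _))) = edge u w
  consistent _ = false

  tokens : List Token
  tokens = cartesianProduct maybeNodes firstStates

  isKeptSourceOf : ℕ × ℕ → Bool
  isKeptSourceOf (i , k) = not (keptAt i) ∧ (keptAt k ∧ leadsTo k i)

  kept-source-enters : ∀ i k w d → k < L → keptAt k ≡ true → leadsTo k i ≡ true →
    firstState (stateAt i) ≡ just (just (w , d)) → just (w , d) ∈ˢ stateAt i → EntersFrom (stateAt k) w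
  kept-source-enters i k w d k<L kept leads first w∈ = entersFrom-prefix (stateAt k) w d (kept-boundary k k<L kept)
    (subst (λ p → just (w , d) ∈ˢ δ* g (stateAt k) p) (cong prefixOfState first)
           (subst (just (w , d) ∈ˢ_) (sym (eqD-true _ _ leads)) w∈))

  -- The node w of the first state of i is entered from k: from the initial state (so w lies in
  -- the first block) or along an edge from the node whose end k is.
  source-consistent : ∀ i k → i < L → k < L → keptAt i ≡ false → keptAt k ≡ true → leadsTo k i ≡ true →
    consistent (token (i , k)) ≡ true
  source-consistent i k i<L k<L not-kept kept leads with stateAt-nonempty i i<L
  ... | t , t∈ with firstState-∈ (stateAt i) t t∈
  ...   | t′ , first , t′∈ with unkept-uniform i i<L not-kept t′ t′∈
  ...     | w , d , refl , _ , _ with kept-shape k k<L kept | kept-source-enters i k w d k<L kept leads first t′∈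
  ... | inj₁ initial | s , s∈ , d₀ , _ , arc rewrite first | trans (cong firstNode initial) firstNode-initialD
        with ∈initial⁻ s (subst (s ∈ˢ_) initial s∈)
  ...   | refl = cong (_≡ᵇ 0) (proj₂ (arc-from-initial w d₀ arc))
  source-consistent i k i<L k<L not-kept kept leads | t , t∈ | t′ , first , t′∈ | w , d , refl , _ , _
    | inj₂ (u , end@(ku , _ , _ , alone)) | s , s∈ , d₀ , d₀≡0 , arc rewrite first | firstNode-endOf u (stateAt k) end with alone s s∈
  ...   | refl with arc-from-state u ku w d₀ arc
  ...     | inj₁ (refl , eq) = contradiction (trans (sym d₀≡0) eq) 0≢1+n
  ...     | inj₂ (_ , uw , _) = uw

  token-consistent : ∀ p → p ∈ cartesianProduct indices indices → isKeptSourceOf p ≡ true →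
    token p ∈ tokens × consistent (token p) ≡ true
  token-consistent (i , k) p∈ is-source with ∈-cartesianProduct⁻ indices indices p∈ | stateAt-nonempty i (∈-upTo⁻ (proj₁ (∈-cartesianProduct⁻ indices indices p∈)))
  ... | i∈ , k∈ | t , t∈ with firstState-∈ (stateAt i) t t∈
  ...   | t′ , first , _ =
    ∈-cartesianProduct⁺ (∈-maybeNodes _) (subst (_∈ firstStates) (sym first) (∈-map⁺ just (∈-states t′))) ,
    source-consistent i k (∈-upTo⁻ i∈) (∈-upTo⁻ k∈) (not-true (∧-conicalˡ _ _ is-source))
      (∧-conicalˡ _ _ k-source) (∧-conicalʳ (keptAt k) _ k-source)
    where
    k-source = ∧-conicalʳ (not (keptAt i)) _ is-source
    not-true : ∀ {b} → not b ≡ true → b ≡ false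
    not-true {false} _ = refl

  token-injective : ∀ {p q} → p ∈ cartesianProduct indices indices → q ∈ cartesianProduct indices indices →
    isKeptSourceOf p ≡ true → isKeptSourceOf q ≡ true → token p ≡ token q → p ≡ q
  token-injective {i , k} {i′ , k′} p∈ q∈ p-source q-source same
    with ∈-cartesianProduct⁻ indices indices p∈ | ∈-cartesianProduct⁻ indices indices q∈
  ... | i∈ , k∈ | i′∈ , k′∈ with kept-injective k∈ k′∈ (∧-conicalˡ _ _ k-source) (∧-conicalˡ _ _ k′-source) (cong proj₁ same)
    where
    k-source = ∧-conicalʳ (not (keptAt i)) _ p-source
    k′-source = ∧-conicalʳ (not (keptAt i′)) _ q-source
  ... | refl = cong (_, k) (stateAt-injective i i′ (∈-upTo⁻ i∈) (∈-upTo⁻ i′∈)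
                 (trans (sym (leads p-source)) (trans (cong (δ* g (stateAt k) ∘ prefixOfState) (cong proj₂ same)) (leads q-source))))
    where
    leads : ∀ {j} → isKeptSourceOf (j , k) ≡ true → δ* g (stateAt k) (prefixOf (stateAt j)) ≡ stateAt j
    leads {j} s = eqD-true _ _ (∧-conicalʳ (keptAt k) _ (∧-conicalʳ (not (keptAt j)) _ s))

  consistent-tokens≤ : count consistent tokens ≤ N g + N g * W g
  consistent-tokens≤ = begin
      count consistent tokens
        ≡⟨ ∑-cartesianProduct maybeNodes firstStates (𝟙 ∘ consistent) ⟩
      row nothing + ∑[ mu ∈ map just (allFin n) ] row mu
        ≤⟨ +-mono-≤ (≤-trans (count≤length (λ mt → consistent (nothing , mt)) firstStates) (≤-reflexive (List.length-map just (states g))))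
                    (≤-reflexive (∑-map just (allFin n) row)) ⟩
      N g + ∑[ u ∈ allFin n ] row (just u)
        ≡⟨ cong (N g +_) (∑-cong (allFin n) (λ u _ → ∑-map just (states g) (λ mt → 𝟙 (consistent (just u , mt))))) ⟩
      N g + ∑[ u ∈ allFin n ] ∑[ t ∈ states g ] 𝟙 (consistent (just u , just t))
        ≡⟨ cong (N g +_) (∑-swap (allFin n) (states g) _) ⟩
      N g + ∑[ t ∈ states g ] count (λ u → consistent (just u , just t)) (allFin n)
        ≤⟨ +-monoʳ-≤ (N g) (∑-mono (states g) (λ t _ → in-neighbours≤W t)) ⟩
      N g + ∑[ _ ∈ states g ] W g
        ≡⟨ cong (N g +_) (∑-const (states g) (W g)) ⟩
      N g + N g * W g ∎
    where
    open ≤-Reasoning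
    row : Maybe (Fin n) → ℕ
    row mu = count (λ mt → consistent (mu , mt)) firstStates
    in-neighbours≤W : ∀ t → count (λ u → consistent (just u , just t)) (allFin n) ≤ W g
    in-neighbours≤W nothing = ≤-trans (≤-reflexive (count-none _ (allFin n) (λ _ _ → refl))) z≤n
    in-neighbours≤W (just (w , _)) = indegree≤W w

  newNodes≤ : newNodes L ≤ N g + N g * W g
  newNodes≤ = begin
      newNodes L
        ≤⟨ ∑-mono indices (λ i i∈ → copies≤sources i (∈-upTo⁻ i∈)) ⟩
      ∑[ i ∈ indices ] count (λ k → isKeptSourceOf (i , k)) indices
        ≡⟨ ∑-cartesianProduct indices indices _ ⟨
      count isKeptSourceOf (cartesianProduct indices indices)
        ≤⟨ count-injection _≟ᵗ_ (cartesianProduct indices indices) tokens isKeptSourceOf consistent token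
             (Unique.cartesianProduct⁺ (Unique.upTo⁺ L) (Unique.upTo⁺ L)) token-consistent token-injective ⟩
      count consistent tokens
        ≤⟨ consistent-tokens≤ ⟩
      N g + N g * W g                                              ∎
    where
    open ≤-Reasoning
    _≟ᵗ_ : DecidableEquality Token
    _≟ᵗ_ = Product.≡-dec (Maybe.≡-dec Fin._≟_) (Maybe.≡-dec (Maybe.≡-dec (Product.≡-dec Fin._≟_ Fin._≟_)))
    copies≤sources : ∀ i → i < L → (if keptAt i then 0 else copies i) ≤ count (λ k → isKeptSourceOf (i , k)) indices
    copies≤sources i i<L with keptAt i in kept
    ... | true = z≤n
    ... | false = subst (_≤ keptSources i) (copies-unkept i kept) (copies≤keptSources i i<L kept)

  unkept≤newNodes : count (not ∘ keptAt) indices ≤ newNodes L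
  unkept≤newNodes = ∑-mono indices λ i i∈ → one≤copies i (∈-upTo⁻ i∈)
    where
    one≤copies : ∀ i → i < L → 𝟙 (not (keptAt i)) ≤ (if keptAt i then 0 else copies i)
    one≤copies i i<L with keptAt i in kept
    ... | true = z≤n
    ... | false = subst (1 ≤_) (copies-unkept i kept) (copies-pos i i<L)

  L≡kept+unkept : L ≡ count keptAt indices + count (not ∘ keptAt) indices
  L≡kept+unkept = sym (trans (count+count-not keptAt indices) (List.length-upTo L))

  nodeCountG′-bound : nodeCountG′ g ord ≤ 3 * N g + 2 * (N g * W g)
  nodeCountG′-bound = begin
    nodeCountG′ g ord
      ≤⟨ nodeCountG′≤L+newNodes acyclic ⟩
    L + newNodes L
      ≡⟨ cong (_+ newNodes L) L≡kept+unkept ⟩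
    count keptAt indices + count (not ∘ keptAt) indices + newNodes L
      ≤⟨ +-mono-≤ (+-mono-≤ kept≤N (≤-trans unkept≤newNodes newNodes≤)) newNodes≤ ⟩
    N g + (N g + N g * W g) + (N g + N g * W g)
      ≡⟨ solve 2 (λ N NW → N :+ (N :+ NW) :+ (N :+ NW) := con 3 :* N :+ con 2 :* NW) refl (N g) (N g * W g) ⟩
    3 * N g + 2 * (N g * W g) ∎
    where open ≤-Reasoning

lemma13 : ∃[ c ] (∀ (σ : ℕ) (g : EBG σ) → WellFormed g → RepeatFree g →
            ∀ (ord : List (DState g)) → Unique ord →
            (∀ (S : DState g) → (S ∈ ord) ⇔ (Reachable g S × NonemptyD g S)) →
            TopOrdered g ord →
            nodeCountG′ g ord ≤ c * (N g * W g) + c)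
lemma13 = 5 , λ σ g wf rf ord unique ord-spec topo → begin
    nodeCountG′ g ord                      ≤⟨ Analysis.nodeCountG′-bound g wf rf ord unique ord-spec topo ⟩
    3 * N g + 2 * (N g * W g)              ≤⟨ +-monoˡ-≤ (2 * (N g * W g)) (*-monoʳ-≤ 3 (Sizes.N≤NW+1 g wf)) ⟩
    3 * (N g * W g + 1) + 2 * (N g * W g)  ≡⟨ solve 1 (λ a → con 3 :* (a :+ con 1) :+ con 2 :* a := con 5 :* a :+ con 3) refl (N g * W g) ⟩
    5 * (N g * W g) + 3                    ≤⟨ +-monoʳ-≤ (5 * (N g * W g)) (m≤m+n 3 2) ⟩
    5 * (N g * W g) + 5                    ∎
  where
  open ≤-Reasoning
  open +-*-Solver
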